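{- For any prime $p\neq2$, the map $\psi_p$ (defined in the context) induces group isomorphisms $\underline{G}(\mathbb{Q}_p)\simeq\mathrm{PGSp}_4(\mathbb{Q}_p)$ and $\underline{G}(\mathbb{Z}_p)\simeq\mathrm{PGSp}_4(\mathbb{Z}_p)$.
   Context: Quaternions over a commutative ring $R$: $\mathbb{H}(R)=R+R\mathbf{i}+R\mathbf{j}+R\mathbf{k}$ with $\mathbf{i}^2=\mathbf{j}^2=\mathbf{k}^2=\mathbf{i}\mathbf{j}\mathbf{k}=-1$, and $z^*=a_0+a_1\mathbf{i}+a_2\mathbf{j}-a_3\mathbf{k}$ for $z=a_0+a_1\mathbf{i}+a_2\mathbf{j}+a_3\mathbf{k}$. $\mathrm{GSV}_2(R)$ is the group of $\begin{pmatrix}a&b\\c&d\end{pmatrix}\in M_2(\mathbb{H}(R))$ with $ad^*-bc^*\in R^\times$ and $ab^*,cd^*\in R+R\mathbf{i}+R\mathbf{j}$; $\underline{G}=\mathrm{PGSV}_2$ is its quotient by its center. With $J=\begin{pmatrix}0&I_2\\-I_2&0\end{pmatrix}$, $\mathrm{GSp}_4(R)=\{M\in M_4(R):MJM^t=\mu J,\ \mu\in R^\times\}$ and $\mathrm{PGSp}_4$ its quotient by scalars. For $p\ne2$ fix $r,s\in\mathbb{Z}_p$ with $r^2+s^2=-1$ and define $\psi_p:\mathbb{H}(\mathbb{Q}_p)\to M_2(\mathbb{Q}_p)$ by $\psi_p(a_0+a_1\mathbf{i}+a_2\mathbf{j}+a_3\mathbf{k})=\begin{pmatrix}a_0+a_1r+a_2s&a_3-a_2r+a_1s\\-a_3-a_2r+a_1s&a_0-a_1r-a_2s\end{pmatrix}$,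 extended entrywise to $2\times2$ quaternionic matrices: $\psi_p\begin{pmatrix}\alpha&\beta\\\gamma&\delta\end{pmatrix}=\begin{pmatrix}\psi_p(\alpha)&\psi_p(\beta)\\\psi_p(\gamma)&\psi_p(\delta)\end{pmatrix}$. -}

module Defs where

open import Level using (Level; _⊔_)
open import Data.Nat as ℕ using (ℕ; zero; suc; NonZero; _^_; _∸_; _/_)
open import Data.Nat.DivMod using (_mod_)
open import Data.Nat.Properties using (m^n≢0)
open import Data.Fin as Fin using (Fin; toℕ)
open import Data.Product using (Σ; ∃; _×_; _,_)
open import Relation.Binary.PropositionalEquality using (_≡_)
open import Algebra.Bundles.Raw using (RawRing)

-- p-adic integers ℤ_p as digit sequences (a = Σ aₙ pⁿ), and
-- p-adic numbers ℚ_p as fractions a / p^k with a ∈ ℤ_p.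
-- Digit representation is canonical, so equality in ℤ_p is pointwise
-- equality of digits.

module PAdic (p : ℕ) .{{p≢0 : NonZero p}} where

  Zp : Set
  Zp = ℕ → Fin p

  digitOf : ℕ → ℕ → Fin p
  digitOf n x = (_/_ x (p ^ n) {{m^n≢0 p n}}) mod p

  trunc : ℕ → Zp → ℕ
  trunc zero    a = 0
  trunc (suc n) a = trunc n a ℕ.+ toℕ (a n) ℕ.* p ^ n

  fromℕ : ℕ → Zp
  fromℕ x n = digitOf n x

  _≈Z_ : Zp → Zp → Set
  a ≈Z b = ∀ n → a n ≡ b n

  _+Z_ : Zp → Zp → Zp
  (a +Z b) n = digitOf n (trunc (suc n) a ℕ.+ trunc (suc n) b)

  _*Z_ : Zp → Zp → Zp
  (a *Z b) n = digitOf n (trunc (suc n) a ℕ.* trunc (suc n) b)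

  -Z_ : Zp → Zp
  (-Z a) n = digitOf n (p ^ suc n ∸ trunc (suc n) a)

  ZpRing : RawRing Level.zero Level.zero
  ZpRing = record
    { Carrier = Zp
    ; _≈_ = _≈Z_
    ; _+_ = _+Z_
    ; _*_ = _*Z_
    ; -_ = -Z_
    ; 0# = fromℕ 0
    ; 1# = fromℕ 1
    }

  SumSqMinusOne : Zp → Zp → Set
  SumSqMinusOne r s = ((r *Z r) +Z (s *Z s)) ≈Z (-Z fromℕ 1)

  record Qp : Set where
    constructor _/p^_
    field
      num : Zp
      den : ℕ
  open Qp public

  _≈Q_ : Qp → Qp → Set
  (a /p^ k) ≈Q (b /p^ l) = (fromℕ (p ^ l) *Z a) ≈Z (fromℕ (p ^ k) *Z b)

  QpRing : RawRing Level.zero Level.zero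
  QpRing = record
    { Carrier = Qp
    ; _≈_ = _≈Q_
    ; _+_ = λ { (a /p^ k) (b /p^ l) →
                ((fromℕ (p ^ l) *Z a) +Z (fromℕ (p ^ k) *Z b)) /p^ (k ℕ.+ l) }
    ; _*_ = λ { (a /p^ k) (b /p^ l) → (a *Z b) /p^ (k ℕ.+ l) }
    ; -_ = λ { (a /p^ k) → (-Z a) /p^ k }
    ; 0# = fromℕ 0 /p^ 0
    ; 1# = fromℕ 1 /p^ 0
    }

  ι : Zp → Qp
  ι a = a /p^ 0

module OverRing {c ℓ : Level} (R : RawRing c ℓ) where
  open RawRing R

  infixl 6 _-_
  _-_ : Carrier → Carrier → Carrier
  x - y = x + (- y)

  IsUnit : Carrier → Set (c ⊔ ℓ)
  IsUnit x = ∃ λ y → x * y ≈ 1#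

  record ℍ : Set c where
    constructor quat
    field
      q0 q1 q2 q3 : Carrier
  open ℍ public

  _≈ℍ_ : ℍ → ℍ → Set ℓ
  x ≈ℍ y = (q0 x ≈ q0 y) × (q1 x ≈ q1 y) × (q2 x ≈ q2 y) × (q3 x ≈ q3 y)

  _+ℍ_ : ℍ → ℍ → ℍ
  quat a0 a1 a2 a3 +ℍ quat b0 b1 b2 b3 = quat (a0 + b0) (a1 + b1) (a2 + b2) (a3 + b3)

  -ℍ_ : ℍ → ℍ
  -ℍ quat a0 a1 a2 a3 = quat (- a0) (- a1) (- a2) (- a3)

  -- Hamilton product: i² = j² = k² = ijk = -1
  _*ℍ_ : ℍ → ℍ → ℍ
  quat a0 a1 a2 a3 *ℍ quat b0 b1 b2 b3 = quat
    (a0 * b0 - a1 * b1 - a2 * b2 - a3 * b3)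
    (a0 * b1 + a1 * b0 + a2 * b3 - a3 * b2)
    (a0 * b2 - a1 * b3 + a2 * b0 + a3 * b1)
    (a0 * b3 + a1 * b2 - a2 * b1 + a3 * b0)

  _* : ℍ → ℍ
  quat a0 a1 a2 a3 * = quat a0 a1 a2 (- a3)

  scalarℍ : Carrier → ℍ
  scalarℍ x = quat x 0# 0# 0#

  record M2ℍ : Set c where
    constructor mat
    field
      ma mb mc md : ℍ
  open M2ℍ public

  _≈M2_ : M2ℍ → M2ℍ → Set ℓ
  M ≈M2 N = (ma M ≈ℍ ma N) × (mb M ≈ℍ mb N) × (mc M ≈ℍ mc N) × (md M ≈ℍ md N)

  _·M2_ : M2ℍ → M2ℍ → M2ℍ
  mat a b c d ·M2 mat e f g h =
    mat ((a *ℍ e) +ℍ (b *ℍ g)) ((a *ℍ f) +ℍ (b *ℍ h))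
        ((c *ℍ e) +ℍ (d *ℍ g)) ((c *ℍ f) +ℍ (d *ℍ h))

  scaleM2 : Carrier → M2ℍ → M2ℍ
  scaleM2 λ' (mat a b c d) =
    mat (scalarℍ λ' *ℍ a) (scalarℍ λ' *ℍ b) (scalarℍ λ' *ℍ c) (scalarℍ λ' *ℍ d)

  InGSV2 : M2ℍ → Set (c ⊔ ℓ)
  InGSV2 (mat a b c d) =
    (∃ λ μ → IsUnit μ × (((a *ℍ (d *)) +ℍ (-ℍ (b *ℍ (c *)))) ≈ℍ scalarℍ μ))
    × (q3 (a *ℍ (b *)) ≈ 0#)
    × (q3 (c *ℍ (d *)) ≈ 0#)

  -- equality in PGSV₂(R) = GSV₂(R) / centre (scalar matrices λI, λ ∈ R^×)
  _~GSV_ : M2ℍ → M2ℍ → Set (c ⊔ ℓ)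
  M ~GSV N = ∃ λ λ' → IsUnit λ' × (N ≈M2 scaleM2 λ' M)

  infix 4 _≈M4_ _≈M2_ _≈ℍ_
  infixl 7 _·M4_ _·M2_ _*ℍ_
  infixl 6 _+ℍ_

  M4 : Set c
  M4 = Fin 4 → Fin 4 → Carrier

  _≈M4_ : M4 → M4 → Set ℓ
  A ≈M4 B = ∀ i j → A i j ≈ B i j

  sum4 : (Fin 4 → Carrier) → Carrier
  sum4 f = f Fin.zero + f (Fin.suc Fin.zero) + f (Fin.suc (Fin.suc Fin.zero))
           + f (Fin.suc (Fin.suc (Fin.suc Fin.zero)))

  _·M4_ : M4 → M4 → M4
  (A ·M4 B) i j = sum4 (λ k → A i k * B k j)

  transpose : M4 → M4
  transpose A i j = A j i

  scaleM4 : Carrier → M4 → M4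
  scaleM4 λ' A i j = λ' * A i j

  -- J = ( 0 I₂ ; -I₂ 0 )
  J : M4
  J Fin.zero (Fin.suc (Fin.suc Fin.zero)) = 1#
  J (Fin.suc Fin.zero) (Fin.suc (Fin.suc (Fin.suc Fin.zero))) = 1#
  J (Fin.suc (Fin.suc Fin.zero)) Fin.zero = - 1#
  J (Fin.suc (Fin.suc (Fin.suc Fin.zero))) (Fin.suc Fin.zero) = - 1#
  J _ _ = 0#

  InGSp4 : M4 → Set (c ⊔ ℓ)
  InGSp4 M = ∃ λ μ → IsUnit μ × ((M ·M4 J) ·M4 transpose M ≈M4 scaleM4 μ J)

  -- equality in PGSp₄(R) = GSp₄(R) / R^×
  _~GSp_ : M4 → M4 → Set (c ⊔ ℓ)
  A ~GSp B = ∃ λ λ' → IsUnit λ' × (B ≈M4 scaleM4 λ' A)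

  module Psi (r s : Carrier) where

    ψℍ : ℍ → Fin 2 → Fin 2 → Carrier
    ψℍ (quat a0 a1 a2 a3) Fin.zero Fin.zero = a0 + a1 * r + a2 * s
    ψℍ (quat a0 a1 a2 a3) Fin.zero (Fin.suc Fin.zero) = a3 - a2 * r + a1 * s
    ψℍ (quat a0 a1 a2 a3) (Fin.suc Fin.zero) Fin.zero = - a3 - a2 * r + a1 * s
    ψℍ (quat a0 a1 a2 a3) (Fin.suc Fin.zero) (Fin.suc Fin.zero) = a0 - a1 * r - a2 * s

    -- ψ on 2×2 quaternionic matrices, entrywise (block matrix)
    -- index k ∈ {0,1,2,3} of a 4×4 matrix = (block, position in block)
    blk : Fin 4 → Fin 2
    blk Fin.zero = Fin.zero
    blk (Fin.suc Fin.zero) = Fin.zero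
    blk (Fin.suc (Fin.suc _)) = Fin.suc Fin.zero

    pos : Fin 4 → Fin 2
    pos Fin.zero = Fin.zero
    pos (Fin.suc Fin.zero) = Fin.suc Fin.zero
    pos (Fin.suc (Fin.suc Fin.zero)) = Fin.zero
    pos (Fin.suc (Fin.suc (Fin.suc _))) = Fin.suc Fin.zero

    entry : M2ℍ → Fin 2 → Fin 2 → ℍ
    entry M Fin.zero Fin.zero = ma M
    entry M Fin.zero (Fin.suc _) = mb M
    entry M (Fin.suc _) Fin.zero = mc M
    entry M (Fin.suc _) (Fin.suc _) = md M

    ψ : M2ℍ → M4
    ψ M i j = ψℍ (entry M (blk i) (blk j)) (pos i) (pos j)

    record InducesIso : Set (c ⊔ ℓ) where
      field
        maps-into   : ∀ M → InGSV2 M → InGSp4 (ψ M)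
        well-defined : ∀ M N → InGSV2 M → InGSV2 N → M ~GSV N → ψ M ~GSp ψ N
        homomorphism : ∀ M N → InGSV2 M → InGSV2 N → ψ (M ·M2 N) ~GSp (ψ M ·M4 ψ N)
        injective   : ∀ M N → InGSV2 M → InGSV2 N → ψ M ~GSp ψ N → M ~GSV N
        surjective  : ∀ A → InGSp4 A → ∃ λ M → InGSV2 M × (ψ M ~GSp A)

{-# OPTIONS --safe #-}
-- Over any commutative ring R with r² + s² = -1, ψℍ is the splitting ℍ(R) ≅ M₂(R): it is additive,
-- multiplicative, turns the involution * into transposition and, once 2 is invertible, has an explicit
-- inverse φ. Blockwise, ψ is then an injective multiplicative map M₂(ℍ(R)) → M₄(R) with inverse Φ, and
-- ψ(M) J ψ(M)ᵗ = ψ(M Jℍ M†) for Jℍ = (0 1; -1 0) and M† the *-transpose. For M = (a b; c d) the form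
-- M Jℍ M† has diagonal entries 2·(k-part of ab*), 2·(k-part of cd*) and off-diagonal entries ad* - bc* and
-- its *-negative, so (2 being invertible) it equals μ Jℍ exactly when M ∈ GSV₂ with similitude μ. Hence ψ maps
-- GSV₂(R) onto GSp₄(R), scalars onto scalars, and induces the isomorphism of the quotients. For p odd both ℤₚ
-- and ℚₚ are such rings (2 is a unit, -½ having constant digit (p - 1)/2); their ring axioms are read off from
-- truncations, which turn the digit-wise operations into arithmetic modulo pⁿ.
module Submission where

open import Defs
open import Data.Nat using (ℕ; NonZero)
open import Data.Nat.Primality using (Prime)
open import Relation.Binary.PropositionalEquality using (_≢_)
open import Data.Product using (_×_)

open import Level using (0ℓ)
open import Algebra.Bundles using (CommutativeRing; RawRing)
open import Algebra.Solver.Ring.AlmostCommutativeRing using (_-Raw-AlmostCommutative⟶_; fromCommutativeRing)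
open import Data.Fin using (Fin)
open import Data.Fin.Patterns using (0F; 1F; 2F; 3F)
open import Data.Maybe using (Maybe; just; nothing)
import Data.Nat as ℕ
import Data.Nat.Properties as ℕ
import Data.Nat.DivMod as ℕ
open import Data.Product using (∃; _,_; proj₁; proj₂)
open import Data.Vec.N-ary using (N-ary; N-ary-level)
open import Relation.Binary.Bundles using (Setoid)
open import Relation.Binary.PropositionalEquality as ≡ using (_≡_)
open import Relation.Nullary using (yes; no)

-- Integer coefficients for the ring solver over an arbitrary commutative ring: (a , b) stands for a - b.
ℤ-rawRing : RawRing 0ℓ 0ℓ
ℤ-rawRing = record
  { Carrier = ℕ × ℕ
  ; _≈_     = _≡_
  ; _+_     = λ { (a , b) (c , d) → a ℕ.+ c , b ℕ.+ d }
  ; _*_     = λ { (a , b) (c , d) → a ℕ.* c ℕ.+ b ℕ.* d , a ℕ.* d ℕ.+ b ℕ.* c }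
  ; -_      = λ { (a , b) → b , a }
  ; 0#      = 0 , 0
  ; 1#      = 1 , 0
  }

module CommutativeRingSolver {c ℓ} (R : CommutativeRing c ℓ) where
  open import Data.Nat.Base using (zero; suc)
  open CommutativeRing R
  open import Algebra.Properties.Ring ring
    using (-0#≈0#; -‿+-comm; ⁻¹-anti-homo‿-; x[y-z]≈xy-xz; [y-z]x≈yx-zx)
  open import Algebra.Properties.Semiring.Mult.TCOptimised semiring
    using (1+×; ×-homo-+; ×1-homo-*) renaming (_×_ to _×′_)
  open import Algebra.Properties.CommutativeSemigroup +-commutativeSemigroup using (interchange)
  open import Relation.Binary.Reasoning.Setoid setoid

  ⌜_⌝ : ℕ → Carrier
  ⌜ n ⌝ = n ×′ 1#

  -- Chosen so that 0, 1 and -1 denote 0#, 1# and - 1# definitionally, as in the formulas of `Defs`.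
  ⟦_⟧ : ℕ × ℕ → Carrier
  ⟦ a     , zero  ⟧ = ⌜ a ⌝
  ⟦ zero  , suc b ⟧ = - ⌜ suc b ⌝
  ⟦ suc a , suc b ⟧ = ⟦ a , b ⟧

  [x+z]-[y+w]≈[x-y]+[z-w] : ∀ x y z w → (x + z) - (y + w) ≈ (x - y) + (z - w)
  [x+z]-[y+w]≈[x-y]+[z-w] x y z w = trans (+-congˡ (sym (-‿+-comm y w))) (interchange x z (- y) (- w))

  [z+x]-[z+y]≈x-y : ∀ x y z → (z + x) - (z + y) ≈ x - y
  [z+x]-[z+y]≈x-y x y z = begin
    (z + x) - (z + y)   ≈⟨ [x+z]-[y+w]≈[x-y]+[z-w] z z x y ⟩
    (z - z) + (x - y)   ≈⟨ +-congʳ (-‿inverseʳ z) ⟩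
    0# + (x - y)        ≈⟨ +-identityˡ _ ⟩
    x - y               ∎

  ⟦⟧≈difference : ∀ a b → ⟦ a , b ⟧ ≈ ⌜ a ⌝ - ⌜ b ⌝
  ⟦⟧≈difference a       zero    = sym (trans (+-congˡ -0#≈0#) (+-identityʳ _))
  ⟦⟧≈difference zero    (suc b) = sym (+-identityˡ _)
  ⟦⟧≈difference (suc a) (suc b) = begin
    ⟦ a , b ⟧                    ≈⟨ ⟦⟧≈difference a b ⟩
    ⌜ a ⌝ - ⌜ b ⌝                ≈⟨ [z+x]-[z+y]≈x-y ⌜ a ⌝ ⌜ b ⌝ 1# ⟨
    (1# + ⌜ a ⌝) - (1# + ⌜ b ⌝)  ≈⟨ +-cong (1+× a 1#) (-‿cong (1+× b 1#)) ⟨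
    ⌜ suc a ⌝ - ⌜ suc b ⌝        ∎

  ⟦⟧-homo-+ : ∀ a b c d → ⟦ a ℕ.+ c , b ℕ.+ d ⟧ ≈ ⟦ a , b ⟧ + ⟦ c , d ⟧
  ⟦⟧-homo-+ a b c d = begin
    ⟦ a ℕ.+ c , b ℕ.+ d ⟧            ≈⟨ ⟦⟧≈difference (a ℕ.+ c) (b ℕ.+ d) ⟩
    ⌜ a ℕ.+ c ⌝ - ⌜ b ℕ.+ d ⌝        ≈⟨ +-cong (×-homo-+ 1# a c) (-‿cong (×-homo-+ 1# b d)) ⟩
    (⌜ a ⌝ + ⌜ c ⌝) - (⌜ b ⌝ + ⌜ d ⌝)  ≈⟨ [x+z]-[y+w]≈[x-y]+[z-w] ⌜ a ⌝ ⌜ b ⌝ ⌜ c ⌝ ⌜ d ⌝ ⟩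
    (⌜ a ⌝ - ⌜ b ⌝) + (⌜ c ⌝ - ⌜ d ⌝)  ≈⟨ +-cong (⟦⟧≈difference a b) (⟦⟧≈difference c d) ⟨
    ⟦ a , b ⟧ + ⟦ c , d ⟧            ∎

  ⟦⟧-homo-* : ∀ a b c d → ⟦ a ℕ.* c ℕ.+ b ℕ.* d , a ℕ.* d ℕ.+ b ℕ.* c ⟧ ≈ ⟦ a , b ⟧ * ⟦ c , d ⟧
  ⟦⟧-homo-* a b c d = begin
    ⟦ a ℕ.* c ℕ.+ b ℕ.* d , a ℕ.* d ℕ.+ b ℕ.* c ⟧
      ≈⟨ ⟦⟧-homo-+ (a ℕ.* c) (a ℕ.* d) (b ℕ.* d) (b ℕ.* c) ⟩
    ⟦ a ℕ.* c , a ℕ.* d ⟧ + ⟦ b ℕ.* d , b ℕ.* c ⟧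
      ≈⟨ +-cong (⟦⟧≈difference (a ℕ.* c) (a ℕ.* d)) (⟦⟧≈difference (b ℕ.* d) (b ℕ.* c)) ⟩
    (⌜ a ℕ.* c ⌝ - ⌜ a ℕ.* d ⌝) + (⌜ b ℕ.* d ⌝ - ⌜ b ℕ.* c ⌝)
      ≈⟨ +-cong (+-cong (×1-homo-* a c) (-‿cong (×1-homo-* a d)))
                (+-cong (×1-homo-* b d) (-‿cong (×1-homo-* b c))) ⟩
    (A * C - A * D) + (B * D - B * C)   ≈⟨ +-congˡ (⁻¹-anti-homo‿- (B * C) (B * D)) ⟨
    (A * C - A * D) - (B * C - B * D)   ≈⟨ +-cong (x[y-z]≈xy-xz A C D) (-‿cong (x[y-z]≈xy-xz B C D)) ⟨
    A * (C - D) - B * (C - D)           ≈⟨ [y-z]x≈yx-zx (C - D) A B ⟨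
    (A - B) * (C - D)                   ≈⟨ *-cong (⟦⟧≈difference a b) (⟦⟧≈difference c d) ⟨
    ⟦ a , b ⟧ * ⟦ c , d ⟧               ∎
    where A = ⌜ a ⌝; B = ⌜ b ⌝; C = ⌜ c ⌝; D = ⌜ d ⌝

  ⟦⟧-homo-neg : ∀ a b → ⟦ b , a ⟧ ≈ - ⟦ a , b ⟧
  ⟦⟧-homo-neg a b = begin
    ⟦ b , a ⟧          ≈⟨ ⟦⟧≈difference b a ⟩
    ⌜ b ⌝ - ⌜ a ⌝      ≈⟨ ⁻¹-anti-homo‿- ⌜ a ⌝ ⌜ b ⌝ ⟨
    - (⌜ a ⌝ - ⌜ b ⌝)  ≈⟨ -‿cong (⟦⟧≈difference a b) ⟨
    - ⟦ a , b ⟧        ∎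

  ⟦⟧-wellDefined : ∀ a b c d → a ℕ.+ d ≡ b ℕ.+ c → ⟦ a , b ⟧ ≈ ⟦ c , d ⟧
  ⟦⟧-wellDefined a b c d a+d≡b+c = begin
    ⟦ a , b ⟧                          ≈⟨ ⟦⟧≈difference a b ⟩
    ⌜ a ⌝ - ⌜ b ⌝                      ≈⟨ [z+x]-[z+y]≈x-y ⌜ a ⌝ ⌜ b ⌝ ⌜ d ⌝ ⟨
    (⌜ d ⌝ + ⌜ a ⌝) - (⌜ d ⌝ + ⌜ b ⌝)  ≈⟨ +-cong (×-homo-+ 1# d a) (-‿cong (×-homo-+ 1# d b)) ⟨
    ⌜ d ℕ.+ a ⌝ - ⌜ d ℕ.+ b ⌝          ≡⟨ ≡.cong₂ (λ m n → ⌜ m ⌝ - ⌜ n ⌝)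
                                            (≡.trans (ℕ.+-comm d a) a+d≡b+c) (ℕ.+-comm d b) ⟩
    ⌜ b ℕ.+ c ⌝ - ⌜ b ℕ.+ d ⌝          ≈⟨ +-cong (×-homo-+ 1# b c) (-‿cong (×-homo-+ 1# b d)) ⟩
    (⌜ b ⌝ + ⌜ c ⌝) - (⌜ b ⌝ + ⌜ d ⌝)  ≈⟨ [z+x]-[z+y]≈x-y ⌜ c ⌝ ⌜ d ⌝ ⌜ b ⌝ ⟩
    ⌜ c ⌝ - ⌜ d ⌝                      ≈⟨ ⟦⟧≈difference c d ⟨
    ⟦ c , d ⟧                          ∎

  ⟦⟧-homomorphism : ℤ-rawRing -Raw-AlmostCommutative⟶ fromCommutativeRing R
  ⟦⟧-homomorphism = record
    { ⟦_⟧    = ⟦_⟧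
    ; +-homo = λ { (a , b) (c , d) → ⟦⟧-homo-+ a b c d }
    ; *-homo = λ { (a , b) (c , d) → ⟦⟧-homo-* a b c d }
    ; -‿homo = λ { (a , b) → ⟦⟧-homo-neg a b }
    ; 0-homo = refl
    ; 1-homo = refl
    }

  ⟦⟧-≟ : ∀ x y → Maybe (⟦ x ⟧ ≈ ⟦ y ⟧)
  ⟦⟧-≟ (a , b) (c , d) with a ℕ.+ d ℕ.≟ b ℕ.+ c
  ... | yes a+d≡b+c = just (⟦⟧-wellDefined a b c d a+d≡b+c)
  ... | no _        = nothing

  open import Algebra.Solver.Ring ℤ-rawRing (fromCommutativeRing R) ⟦⟧-homomorphism ⟦⟧-≟ public
    using (solve; _:=_; _:+_; _:*_; :-_; con; Polynomial)

module QuaternionicConstructions {c ℓ} (R : RawRing c ℓ) where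
  open RawRing R
  open OverRing R

  matrix₂ : Carrier → Carrier → Carrier → Carrier → Fin 2 → Fin 2 → Carrier
  matrix₂ x y z w 0F 0F = x
  matrix₂ x y z w 0F 1F = y
  matrix₂ x y z w 1F 0F = z
  matrix₂ x y z w 1F 1F = w

  -- The inverse of ψℍ, given ½ = 1/2: if X = ψℍ a then, with u, v as below, r u + s v = (r² + s²) a₁
  -- and s u - r v = (r² + s²) a₂.
  φ : (r s ½ : Carrier) → (Fin 2 → Fin 2 → Carrier) → ℍ
  φ r s ½ X = quat (½ * (X 0F 0F + X 1F 1F)) (- (r * u + s * v)) (- (s * u - r * v)) (½ * (X 0F 1F - X 1F 0F))
    where
    u = ½ * (X 0F 0F - X 1F 1F)
    v = ½ * (X 0F 1F + X 1F 0F)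

  Jℍ : Carrier → M2ℍ
  Jℍ μ = mat (scalarℍ 0#) (scalarℍ μ) (scalarℍ (- μ)) (scalarℍ 0#)

  adjoint : M2ℍ → M2ℍ
  adjoint (mat a b c d) = mat (a *) (c *) (b *) (d *)

  symplecticForm : M2ℍ → M2ℍ
  symplecticForm M = M ·M2 Jℍ 1# ·M2 adjoint M

  similitude : M2ℍ → ℍ
  similitude (mat a b c d) = a *ℍ (d *) +ℍ -ℍ (b *ℍ (c *))

  component : Fin 4 → ℍ → Carrier
  component 0F = q0
  component 1F = q1
  component 2F = q2
  component 3F = q3

  twiceK : ℍ → ℍ
  twiceK x = quat 0# 0# 0# ((1# + 1#) * q3 x)

module PsiIsomorphism {c ℓ} (R : CommutativeRing c ℓ) (r s : CommutativeRing.Carrier R) where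
  open CommutativeRing R hiding (_-_)
  open OverRing rawRing
  open Psi r s
  open QuaternionicConstructions rawRing
  open CommutativeRingSolver R using (solve; _:=_; _:+_; _:*_; :-_; con; Polynomial)
  open import Algebra.Properties.Ring ring using (-‿involutive; -0#≈0#)
  open import Relation.Binary.Reasoning.Setoid setoid

  -- `′` is `Defs` and `QuaternionicConstructions` over polynomial syntax; a name ending in ′ is the polynomial
  -- identity behind the unprimed lemma, written with the very formulas of `Defs` so that the solver sees them.
  Syntax : ℕ → RawRing 0ℓ 0ℓ
  Syntax n = record
    { Carrier = Polynomial n ; _≈_ = _≡_ ; _+_ = _:+_ ; _*_ = _:*_ ; -_ = :-_
    ; 0# = con (0 , 0) ; 1# = con (1 , 0) }

  module ′ {n : ℕ} where
    open OverRing (Syntax n) public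
    open QuaternionicConstructions (Syntax n) public

  PolynomialIdentity : (n : ℕ) → Set (N-ary-level 0ℓ 0ℓ n)
  PolynomialIdentity n = N-ary n (Polynomial n) (Polynomial n × Polynomial n)

  ≈ℍ-sym : ∀ {x y} → x ≈ℍ y → y ≈ℍ x
  ≈ℍ-sym (e₀ , e₁ , e₂ , e₃) = sym e₀ , sym e₁ , sym e₂ , sym e₃

  ≈ℍ-trans : ∀ {x y z} → x ≈ℍ y → y ≈ℍ z → x ≈ℍ z
  ≈ℍ-trans (e₀ , e₁ , e₂ , e₃) (f₀ , f₁ , f₂ , f₃) = trans e₀ f₀ , trans e₁ f₁ , trans e₂ f₂ , trans e₃ f₃

  ≈ℍ-by-components : ∀ {x y} → (∀ k → component k x ≈ component k y) → x ≈ℍ y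
  ≈ℍ-by-components e = e 0F , e 1F , e 2F , e 3F

  ψℍ-cong : ∀ {x y} → x ≈ℍ y → ∀ i j → ψℍ x i j ≈ ψℍ y i j
  ψℍ-cong (e₀ , e₁ , e₂ , e₃) 0F 0F = +-cong (+-cong e₀ (*-congʳ e₁)) (*-congʳ e₂)
  ψℍ-cong (e₀ , e₁ , e₂ , e₃) 0F 1F = +-cong (+-cong e₃ (-‿cong (*-congʳ e₂))) (*-congʳ e₁)
  ψℍ-cong (e₀ , e₁ , e₂ , e₃) 1F 0F = +-cong (+-cong (-‿cong e₃) (-‿cong (*-congʳ e₂))) (*-congʳ e₁)
  ψℍ-cong (e₀ , e₁ , e₂ , e₃) 1F 1F = +-cong (+-cong e₀ (-‿cong (*-congʳ e₁))) (-‿cong (*-congʳ e₂))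

  -- Identities that hold only modulo r² + s² + 1 or 2½ - 1 are solved in the form x = y + z q,
  -- with the cofactor q written out.
  ≈-modulo : ∀ {x y z q} → z ≈ 0# → x ≈ y + z * q → x ≈ y
  ≈-modulo {x} {y} {z} {q} z≈0 x≈y+zq = begin
    x           ≈⟨ x≈y+zq ⟩
    y + z * q   ≈⟨ +-congˡ (trans (*-congʳ z≈0) (zeroˡ q)) ⟩
    y + 0#      ≈⟨ +-identityʳ y ⟩
    y           ∎

  1#-isUnit : IsUnit 1#
  1#-isUnit = 1# , *-identityˡ 1#

  ψℍ-+′ : Fin 2 → Fin 2 → PolynomialIdentity 10
  ψℍ-+′ i j a₀ a₁ a₂ a₃ b₀ b₁ b₂ b₃ r s =
    ′.Psi.ψℍ r s (x ′.+ℍ y) i j := ′.Psi.ψℍ r s x i j :+ ′.Psi.ψℍ r s y i j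
    where x = ′.quat a₀ a₁ a₂ a₃; y = ′.quat b₀ b₁ b₂ b₃

  ψℍ-+ : ∀ x y i j → ψℍ (x +ℍ y) i j ≈ ψℍ x i j + ψℍ y i j
  ψℍ-+ (quat a₀ a₁ a₂ a₃) (quat b₀ b₁ b₂ b₃) 0F 0F =
    solve 10 (ψℍ-+′ 0F 0F) refl a₀ a₁ a₂ a₃ b₀ b₁ b₂ b₃ r s
  ψℍ-+ (quat a₀ a₁ a₂ a₃) (quat b₀ b₁ b₂ b₃) 0F 1F =
    solve 10 (ψℍ-+′ 0F 1F) refl a₀ a₁ a₂ a₃ b₀ b₁ b₂ b₃ r s
  ψℍ-+ (quat a₀ a₁ a₂ a₃) (quat b₀ b₁ b₂ b₃) 1F 0F =
    solve 10 (ψℍ-+′ 1F 0F) refl a₀ a₁ a₂ a₃ b₀ b₁ b₂ b₃ r s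
  ψℍ-+ (quat a₀ a₁ a₂ a₃) (quat b₀ b₁ b₂ b₃) 1F 1F =
    solve 10 (ψℍ-+′ 1F 1F) refl a₀ a₁ a₂ a₃ b₀ b₁ b₂ b₃ r s

  ψℍ-scalar′ : Fin 2 → Fin 2 → PolynomialIdentity 7
  ψℍ-scalar′ i j μ a₀ a₁ a₂ a₃ r s = ′.Psi.ψℍ r s (′.scalarℍ μ ′.*ℍ x) i j := μ :* ′.Psi.ψℍ r s x i j
    where x = ′.quat a₀ a₁ a₂ a₃

  ψℍ-scalar : ∀ μ x i j → ψℍ (scalarℍ μ *ℍ x) i j ≈ μ * ψℍ x i j
  ψℍ-scalar μ (quat a₀ a₁ a₂ a₃) 0F 0F = solve 7 (ψℍ-scalar′ 0F 0F) refl μ a₀ a₁ a₂ a₃ r s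
  ψℍ-scalar μ (quat a₀ a₁ a₂ a₃) 0F 1F = solve 7 (ψℍ-scalar′ 0F 1F) refl μ a₀ a₁ a₂ a₃ r s
  ψℍ-scalar μ (quat a₀ a₁ a₂ a₃) 1F 0F = solve 7 (ψℍ-scalar′ 1F 0F) refl μ a₀ a₁ a₂ a₃ r s
  ψℍ-scalar μ (quat a₀ a₁ a₂ a₃) 1F 1F = solve 7 (ψℍ-scalar′ 1F 1F) refl μ a₀ a₁ a₂ a₃ r s

  ψℍ-conj : ∀ x i j → ψℍ (x *) i j ≈ ψℍ x j i
  ψℍ-conj x                  0F 0F = refl
  ψℍ-conj x                  0F 1F = refl
  ψℍ-conj (quat a₀ a₁ a₂ a₃) 1F 0F = +-congʳ (+-congʳ (-‿involutive a₃))
  ψℍ-conj x                  1F 1F = refl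

  index : Fin 2 → Fin 2 → Fin 4
  index 0F 0F = 0F
  index 0F 1F = 1F
  index 1F 0F = 2F
  index 1F 1F = 3F

  blk-index : ∀ B i → blk (index B i) ≡ B
  blk-index 0F 0F = ≡.refl
  blk-index 0F 1F = ≡.refl
  blk-index 1F 0F = ≡.refl
  blk-index 1F 1F = ≡.refl

  pos-index : ∀ B i → pos (index B i) ≡ i
  pos-index 0F 0F = ≡.refl
  pos-index 0F 1F = ≡.refl
  pos-index 1F 0F = ≡.refl
  pos-index 1F 1F = ≡.refl

  index-blk-pos : ∀ k → index (blk k) (pos k) ≡ k
  index-blk-pos 0F = ≡.refl
  index-blk-pos 1F = ≡.refl
  index-blk-pos 2F = ≡.refl
  index-blk-pos 3F = ≡.refl

  block : M4 → Fin 2 → Fin 2 → Fin 2 → Fin 2 → Carrier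
  block A B C i j = A (index B i) (index C j)

  ψ-index : ∀ M B C i j → ψ M (index B i) (index C j) ≡ ψℍ (entry M B C) i j
  ψ-index M B C i j rewrite blk-index B i | blk-index C j | pos-index B i | pos-index C j = ≡.refl

  ≈M2-by-entries : ∀ {M N} → (∀ B C → entry M B C ≈ℍ entry N B C) → M ≈M2 N
  ≈M2-by-entries e = e 0F 0F , e 0F 1F , e 1F 0F , e 1F 1F

  entry-cong : ∀ {M N} → M ≈M2 N → ∀ B C → entry M B C ≈ℍ entry N B C
  entry-cong (e₀₀ , e₀₁ , e₁₀ , e₁₁) 0F 0F = e₀₀
  entry-cong (e₀₀ , e₀₁ , e₁₀ , e₁₁) 0F 1F = e₀₁
  entry-cong (e₀₀ , e₀₁ , e₁₀ , e₁₁) 1F 0F = e₁₀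
  entry-cong (e₀₀ , e₀₁ , e₁₀ , e₁₁) 1F 1F = e₁₁

  entry-·M2 : ∀ M N B C → entry (M ·M2 N) B C ≡ entry M B 0F *ℍ entry N 0F C +ℍ entry M B 1F *ℍ entry N 1F C
  entry-·M2 M N 0F 0F = ≡.refl
  entry-·M2 M N 0F 1F = ≡.refl
  entry-·M2 M N 1F 0F = ≡.refl
  entry-·M2 M N 1F 1F = ≡.refl

  entry-scaleM2 : ∀ μ M B C → entry (scaleM2 μ M) B C ≡ scalarℍ μ *ℍ entry M B C
  entry-scaleM2 μ M 0F 0F = ≡.refl
  entry-scaleM2 μ M 0F 1F = ≡.refl
  entry-scaleM2 μ M 1F 0F = ≡.refl
  entry-scaleM2 μ M 1F 1F = ≡.refl

  entry-adjoint : ∀ M B C → entry (adjoint M) B C ≡ entry M C B *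
  entry-adjoint M 0F 0F = ≡.refl
  entry-adjoint M 0F 1F = ≡.refl
  entry-adjoint M 1F 0F = ≡.refl
  entry-adjoint M 1F 1F = ≡.refl

  ≈M4-refl : ∀ {A} → A ≈M4 A
  ≈M4-refl i j = refl

  ≈M4-sym : ∀ {A B} → A ≈M4 B → B ≈M4 A
  ≈M4-sym e i j = sym (e i j)

  ≈M4-trans : ∀ {A B C} → A ≈M4 B → B ≈M4 C → A ≈M4 C
  ≈M4-trans e f i j = trans (e i j) (f i j)

  ·M4-cong : ∀ {A A′ B B′} → A ≈M4 A′ → B ≈M4 B′ → A ·M4 B ≈M4 A′ ·M4 B′
  ·M4-cong e f i j = +-cong (+-cong (+-cong (*-cong (e i 0F) (f 0F j)) (*-cong (e i 1F) (f 1F j)))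
                                    (*-cong (e i 2F) (f 2F j)))
                            (*-cong (e i 3F) (f 3F j))

  ψ-cong : ∀ {M N} → M ≈M2 N → ψ M ≈M4 ψ N
  ψ-cong e i j = ψℍ-cong (entry-cong e (blk i) (blk j)) (pos i) (pos j)

  ψ-scaleM2 : ∀ μ M → ψ (scaleM2 μ M) ≈M4 scaleM4 μ (ψ M)
  ψ-scaleM2 μ M i j = begin
    ψ (scaleM2 μ M) i j
      ≡⟨ ≡.cong (λ x → ψℍ x (pos i) (pos j)) (entry-scaleM2 μ M (blk i) (blk j)) ⟩
    ψℍ (scalarℍ μ *ℍ entry M (blk i) (blk j)) (pos i) (pos j)
      ≈⟨ ψℍ-scalar μ _ (pos i) (pos j) ⟩
    μ * ψ M i j ∎

  ψ-adjoint : ∀ M → ψ (adjoint M) ≈M4 transpose (ψ M)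
  ψ-adjoint M i j = begin
    ψ (adjoint M) i j
      ≡⟨ ≡.cong (λ x → ψℍ x (pos i) (pos j)) (entry-adjoint M (blk i) (blk j)) ⟩
    ψℍ (entry M (blk j) (blk i) *) (pos i) (pos j)
      ≈⟨ ψℍ-conj _ (pos i) (pos j) ⟩
    ψ M j i ∎

  ψ-Jℍ′ : Fin 4 → Fin 4 → PolynomialIdentity 3
  ψ-Jℍ′ i j μ r s = ′.Psi.ψ r s (′.Jℍ μ) i j := μ :* ′.J i j

  ψ-Jℍ : ∀ μ → ψ (Jℍ μ) ≈M4 scaleM4 μ J
  ψ-Jℍ μ 0F 0F = solve 3 (ψ-Jℍ′ 0F 0F) refl μ r s
  ψ-Jℍ μ 0F 1F = solve 3 (ψ-Jℍ′ 0F 1F) refl μ r s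
  ψ-Jℍ μ 0F 2F = solve 3 (ψ-Jℍ′ 0F 2F) refl μ r s
  ψ-Jℍ μ 0F 3F = solve 3 (ψ-Jℍ′ 0F 3F) refl μ r s
  ψ-Jℍ μ 1F 0F = solve 3 (ψ-Jℍ′ 1F 0F) refl μ r s
  ψ-Jℍ μ 1F 1F = solve 3 (ψ-Jℍ′ 1F 1F) refl μ r s
  ψ-Jℍ μ 1F 2F = solve 3 (ψ-Jℍ′ 1F 2F) refl μ r s
  ψ-Jℍ μ 1F 3F = solve 3 (ψ-Jℍ′ 1F 3F) refl μ r s
  ψ-Jℍ μ 2F 0F = solve 3 (ψ-Jℍ′ 2F 0F) refl μ r s
  ψ-Jℍ μ 2F 1F = solve 3 (ψ-Jℍ′ 2F 1F) refl μ r s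
  ψ-Jℍ μ 2F 2F = solve 3 (ψ-Jℍ′ 2F 2F) refl μ r s
  ψ-Jℍ μ 2F 3F = solve 3 (ψ-Jℍ′ 2F 3F) refl μ r s
  ψ-Jℍ μ 3F 0F = solve 3 (ψ-Jℍ′ 3F 0F) refl μ r s
  ψ-Jℍ μ 3F 1F = solve 3 (ψ-Jℍ′ 3F 1F) refl μ r s
  ψ-Jℍ μ 3F 2F = solve 3 (ψ-Jℍ′ 3F 2F) refl μ r s
  ψ-Jℍ μ 3F 3F = solve 3 (ψ-Jℍ′ 3F 3F) refl μ r s

  symplecticForm-diagonal′ : Fin 4 → PolynomialIdentity 8
  symplecticForm-diagonal′ k x₀ x₁ x₂ x₃ y₀ y₁ y₂ y₃ =
    ′.component k (′.ma (′.symplecticForm (′.mat x y x y))) := ′.component k (′.twiceK (x ′.*ℍ (y ′.*)))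
    where
    x = ′.quat x₀ x₁ x₂ x₃
    y = ′.quat y₀ y₁ y₂ y₃

  symplecticForm-01′ : Fin 4 → PolynomialIdentity 16
  symplecticForm-01′ k a₀ a₁ a₂ a₃ b₀ b₁ b₂ b₃ c₀ c₁ c₂ c₃ d₀ d₁ d₂ d₃ =
    ′.component k (′.mb (′.symplecticForm M)) := ′.component k (′.similitude M)
    where
    M = ′.mat (′.quat a₀ a₁ a₂ a₃) (′.quat b₀ b₁ b₂ b₃) (′.quat c₀ c₁ c₂ c₃) (′.quat d₀ d₁ d₂ d₃)

  symplecticForm-10′ : Fin 4 → PolynomialIdentity 16
  symplecticForm-10′ k a₀ a₁ a₂ a₃ b₀ b₁ b₂ b₃ c₀ c₁ c₂ c₃ d₀ d₁ d₂ d₃ =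
    ′.component k (′.mc (′.symplecticForm M)) := ′.component k (′.-ℍ (′.similitude M ′.*))
    where
    M = ′.mat (′.quat a₀ a₁ a₂ a₃) (′.quat b₀ b₁ b₂ b₃) (′.quat c₀ c₁ c₂ c₃) (′.quat d₀ d₁ d₂ d₃)

  symplecticForm-diagonal : ∀ x y z w → ma (symplecticForm (mat x y z w)) ≈ℍ twiceK (x *ℍ (y *))
  symplecticForm-diagonal (quat x₀ x₁ x₂ x₃) (quat y₀ y₁ y₂ y₃) z w = ≈ℍ-by-components λ where
    0F → solve 8 (symplecticForm-diagonal′ 0F) refl x₀ x₁ x₂ x₃ y₀ y₁ y₂ y₃
    1F → solve 8 (symplecticForm-diagonal′ 1F) refl x₀ x₁ x₂ x₃ y₀ y₁ y₂ y₃
    2F → solve 8 (symplecticForm-diagonal′ 2F) refl x₀ x₁ x₂ x₃ y₀ y₁ y₂ y₃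
    3F → solve 8 (symplecticForm-diagonal′ 3F) refl x₀ x₁ x₂ x₃ y₀ y₁ y₂ y₃

  symplecticForm-≈ : ∀ M → symplecticForm M ≈M2
    mat (twiceK (ma M *ℍ (mb M *))) (similitude M) (-ℍ (similitude M *)) (twiceK (mc M *ℍ (md M *)))
  symplecticForm-≈
    M@(mat a@(quat a₀ a₁ a₂ a₃) b@(quat b₀ b₁ b₂ b₃) c@(quat c₀ c₁ c₂ c₃) d@(quat d₀ d₁ d₂ d₃)) =
    symplecticForm-diagonal a b c d , ≈ℍ-by-components entry₀₁ , ≈ℍ-by-components entry₁₀ ,
    symplecticForm-diagonal c d a b
    -- The lower right entry for (a b; c d) is the upper left one for (c d; a b).
    where
    entry₀₁ : ∀ k → component k (mb (symplecticForm M)) ≈ component k (similitude M)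
    entry₀₁ 0F = solve 16 (symplecticForm-01′ 0F) refl a₀ a₁ a₂ a₃ b₀ b₁ b₂ b₃ c₀ c₁ c₂ c₃ d₀ d₁ d₂ d₃
    entry₀₁ 1F = solve 16 (symplecticForm-01′ 1F) refl a₀ a₁ a₂ a₃ b₀ b₁ b₂ b₃ c₀ c₁ c₂ c₃ d₀ d₁ d₂ d₃
    entry₀₁ 2F = solve 16 (symplecticForm-01′ 2F) refl a₀ a₁ a₂ a₃ b₀ b₁ b₂ b₃ c₀ c₁ c₂ c₃ d₀ d₁ d₂ d₃
    entry₀₁ 3F = solve 16 (symplecticForm-01′ 3F) refl a₀ a₁ a₂ a₃ b₀ b₁ b₂ b₃ c₀ c₁ c₂ c₃ d₀ d₁ d₂ d₃
    entry₁₀ : ∀ k → component k (mc (symplecticForm M)) ≈ component k (-ℍ (similitude M *))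
    entry₁₀ 0F = solve 16 (symplecticForm-10′ 0F) refl a₀ a₁ a₂ a₃ b₀ b₁ b₂ b₃ c₀ c₁ c₂ c₃ d₀ d₁ d₂ d₃
    entry₁₀ 1F = solve 16 (symplecticForm-10′ 1F) refl a₀ a₁ a₂ a₃ b₀ b₁ b₂ b₃ c₀ c₁ c₂ c₃ d₀ d₁ d₂ d₃
    entry₁₀ 2F = solve 16 (symplecticForm-10′ 2F) refl a₀ a₁ a₂ a₃ b₀ b₁ b₂ b₃ c₀ c₁ c₂ c₃ d₀ d₁ d₂ d₃
    entry₁₀ 3F = solve 16 (symplecticForm-10′ 3F) refl a₀ a₁ a₂ a₃ b₀ b₁ b₂ b₃ c₀ c₁ c₂ c₃ d₀ d₁ d₂ d₃

  InGSV2⇒symplectic : ∀ M → InGSV2 M → ∃ λ μ → IsUnit μ × symplecticForm M ≈M2 Jℍ μ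
  InGSV2⇒symplectic M@(mat a b c d) ((μ , μ-unit , ν≈μ) , ab*∈span , cd*∈span) =
    μ , μ-unit , (≈ℍ-trans e₀₀ (twiceK-0 (a *ℍ (b *)) ab*∈span) , ≈ℍ-trans e₀₁ ν≈μ ,
                  ≈ℍ-trans e₁₀ (-conj-scalar ν≈μ) , ≈ℍ-trans e₁₁ (twiceK-0 (c *ℍ (d *)) cd*∈span))
    where
    e = symplecticForm-≈ M
    e₀₀ = proj₁ e
    e₀₁ = proj₁ (proj₂ e)
    e₁₀ = proj₁ (proj₂ (proj₂ e))
    e₁₁ = proj₂ (proj₂ (proj₂ e))
    twiceK-0 : ∀ x → q3 x ≈ 0# → twiceK x ≈ℍ scalarℍ 0#
    twiceK-0 x x₃≈0 = refl , refl , refl , trans (*-congˡ x₃≈0) (zeroʳ _)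
    -conj-scalar : ∀ {x μ} → x ≈ℍ scalarℍ μ → -ℍ (x *) ≈ℍ scalarℍ (- μ)
    -conj-scalar (x₀≈μ , x₁≈0 , x₂≈0 , x₃≈0) =
      -‿cong x₀≈μ , trans (-‿cong x₁≈0) -0#≈0# , trans (-‿cong x₂≈0) -0#≈0# , trans (-‿involutive _) x₃≈0

  ψℍ-*′ : Fin 2 → Fin 2 → PolynomialIdentity 10
  ψℍ-*′ i j a₀ a₁ a₂ a₃ b₀ b₁ b₂ b₃ r s =
    ′.Psi.ψℍ r s (x ′.*ℍ y) i j
      := ′.Psi.ψℍ r s x i 0F :* ′.Psi.ψℍ r s y 0F j :+ ′.Psi.ψℍ r s x i 1F :* ′.Psi.ψℍ r s y 1F j
         :+ (r :* r :+ s :* s :+ con (1 , 0)) :* cofactor i j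
    where
    x = ′.quat a₀ a₁ a₂ a₃
    y = ′.quat b₀ b₁ b₂ b₃
    cofactor : Fin 2 → Fin 2 → Polynomial 10
    cofactor 0F 0F = :- (a₁ :* b₁ :+ a₂ :* b₂)
    cofactor 0F 1F = a₁ :* b₂ :+ :- (a₂ :* b₁)
    cofactor 1F 0F = a₂ :* b₁ :+ :- (a₁ :* b₂)
    cofactor 1F 1F = :- (a₁ :* b₁ :+ a₂ :* b₂)

  φ-ψℍ′ : Fin 4 → PolynomialIdentity 7
  φ-ψℍ′ k a₀ a₁ a₂ a₃ r s ½ =
    ′.component k (′.φ r s ½ (′.Psi.ψℍ r s x))
      := ′.component k x :+ (½ :* two :+ :- one) :* ′.component k x
         :+ (r :* r :+ s :* s :+ one) :* cofactor k
    where
    one two : Polynomial 7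
    one = con (1 , 0)
    two = con (2 , 0)
    x = ′.quat a₀ a₁ a₂ a₃
    cofactor : Fin 4 → Polynomial 7
    cofactor 0F = con (0 , 0)
    cofactor 1F = :- (two :* a₁ :* ½)
    cofactor 2F = :- (two :* a₂ :* ½)
    cofactor 3F = con (0 , 0)

  ψℍ-φ′ : Fin 2 → Fin 2 → PolynomialIdentity 7
  ψℍ-φ′ i j x₀₀ x₀₁ x₁₀ x₁₁ r s ½ =
    ′.Psi.ψℍ r s (′.φ r s ½ X) i j
      := X i j :+ (½ :* two :+ :- one) :* X i j :+ (r :* r :+ s :* s :+ one) :* cofactor i j
    where
    one two : Polynomial 7
    one = con (1 , 0)
    two = con (2 , 0)
    X = ′.matrix₂ x₀₀ x₀₁ x₁₀ x₁₁
    cofactor : Fin 2 → Fin 2 → Polynomial 7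
    cofactor 0F 0F = :- (½ :* x₀₀) :+ ½ :* x₁₁
    cofactor 0F 1F = :- (½ :* x₀₁) :+ :- (½ :* x₁₀)
    cofactor 1F 0F = :- (½ :* x₀₁) :+ :- (½ :* x₁₀)
    cofactor 1F 1F = ½ :* x₀₀ :+ :- (½ :* x₁₁)

  module _ (r²+s²≈-1 : r * r + s * s ≈ - 1#) where

    r²+s²+1≈0 : r * r + s * s + 1# ≈ 0#
    r²+s²+1≈0 = trans (+-congʳ r²+s²≈-1) (-‿inverseˡ 1#)

    ψℍ-* : ∀ x y i j → ψℍ (x *ℍ y) i j ≈ ψℍ x i 0F * ψℍ y 0F j + ψℍ x i 1F * ψℍ y 1F j
    ψℍ-* (quat a₀ a₁ a₂ a₃) (quat b₀ b₁ b₂ b₃) 0F 0F =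
      ≈-modulo r²+s²+1≈0 (solve 10 (ψℍ-*′ 0F 0F) refl a₀ a₁ a₂ a₃ b₀ b₁ b₂ b₃ r s)
    ψℍ-* (quat a₀ a₁ a₂ a₃) (quat b₀ b₁ b₂ b₃) 0F 1F =
      ≈-modulo r²+s²+1≈0 (solve 10 (ψℍ-*′ 0F 1F) refl a₀ a₁ a₂ a₃ b₀ b₁ b₂ b₃ r s)
    ψℍ-* (quat a₀ a₁ a₂ a₃) (quat b₀ b₁ b₂ b₃) 1F 0F =
      ≈-modulo r²+s²+1≈0 (solve 10 (ψℍ-*′ 1F 0F) refl a₀ a₁ a₂ a₃ b₀ b₁ b₂ b₃ r s)
    ψℍ-* (quat a₀ a₁ a₂ a₃) (quat b₀ b₁ b₂ b₃) 1F 1F =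
      ≈-modulo r²+s²+1≈0 (solve 10 (ψℍ-*′ 1F 1F) refl a₀ a₁ a₂ a₃ b₀ b₁ b₂ b₃ r s)

    ψ-·M2 : ∀ M N → ψ (M ·M2 N) ≈M4 ψ M ·M4 ψ N
    ψ-·M2 M N i j = begin
      ψ (M ·M2 N) i j
        ≡⟨ ≡.cong (λ x → ψℍ x (pos i) (pos j)) (entry-·M2 M N (blk i) (blk j)) ⟩
      ψℍ (x₀ *ℍ y₀ +ℍ x₁ *ℍ y₁) (pos i) (pos j)
        ≈⟨ ψℍ-+ (x₀ *ℍ y₀) (x₁ *ℍ y₁) (pos i) (pos j) ⟩
      ψℍ (x₀ *ℍ y₀) (pos i) (pos j) + ψℍ (x₁ *ℍ y₁) (pos i) (pos j)
        ≈⟨ +-cong (ψℍ-* x₀ y₀ (pos i) (pos j)) (ψℍ-* x₁ y₁ (pos i) (pos j)) ⟩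
      (ψ M i 0F * ψ N 0F j + ψ M i 1F * ψ N 1F j) + (ψ M i 2F * ψ N 2F j + ψ M i 3F * ψ N 3F j)
        ≈⟨ +-assoc _ _ _ ⟨
      (ψ M ·M4 ψ N) i j ∎
      where
      x₀ = entry M (blk i) 0F
      x₁ = entry M (blk i) 1F
      y₀ = entry N 0F (blk j)
      y₁ = entry N 1F (blk j)

    ψ-symplecticForm : ∀ M → ψ (symplecticForm M) ≈M4 ψ M ·M4 J ·M4 transpose (ψ M)
    ψ-symplecticForm M =
      ≈M4-trans (ψ-·M2 (M ·M2 Jℍ 1#) (adjoint M))
                (·M4-cong (≈M4-trans (ψ-·M2 M (Jℍ 1#)) (·M4-cong (≈M4-refl {ψ M}) ψ-Jℍ1)) (ψ-adjoint M))
      where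
      ψ-Jℍ1 : ψ (Jℍ 1#) ≈M4 J
      ψ-Jℍ1 i j = trans (ψ-Jℍ 1# i j) (*-identityˡ (J i j))

    module _ (½ : Carrier) (½-inverse : ½ * (1# + 1#) ≈ 1#) where

      2½-1≈0 : ½ * (1# + 1#) + - 1# ≈ 0#
      2½-1≈0 = trans (+-congʳ ½-inverse) (-‿inverseʳ 1#)

      φ-ψℍ : ∀ x → φ r s ½ (ψℍ x) ≈ℍ x
      φ-ψℍ (quat a₀ a₁ a₂ a₃) = ≈ℍ-by-components λ where
        0F → ≈-modulo 2½-1≈0 (≈-modulo r²+s²+1≈0 (solve 7 (φ-ψℍ′ 0F) refl a₀ a₁ a₂ a₃ r s ½))
        1F → ≈-modulo 2½-1≈0 (≈-modulo r²+s²+1≈0 (solve 7 (φ-ψℍ′ 1F) refl a₀ a₁ a₂ a₃ r s ½))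
        2F → ≈-modulo 2½-1≈0 (≈-modulo r²+s²+1≈0 (solve 7 (φ-ψℍ′ 2F) refl a₀ a₁ a₂ a₃ r s ½))
        3F → ≈-modulo 2½-1≈0 (≈-modulo r²+s²+1≈0 (solve 7 (φ-ψℍ′ 3F) refl a₀ a₁ a₂ a₃ r s ½))

      ψℍ-φ : ∀ X i j → ψℍ (φ r s ½ X) i j ≈ X i j
      ψℍ-φ X 0F 0F = ≈-modulo 2½-1≈0 (≈-modulo r²+s²+1≈0
        (solve 7 (ψℍ-φ′ 0F 0F) refl (X 0F 0F) (X 0F 1F) (X 1F 0F) (X 1F 1F) r s ½))
      ψℍ-φ X 0F 1F = ≈-modulo 2½-1≈0 (≈-modulo r²+s²+1≈0
        (solve 7 (ψℍ-φ′ 0F 1F) refl (X 0F 0F) (X 0F 1F) (X 1F 0F) (X 1F 1F) r s ½))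
      ψℍ-φ X 1F 0F = ≈-modulo 2½-1≈0 (≈-modulo r²+s²+1≈0
        (solve 7 (ψℍ-φ′ 1F 0F) refl (X 0F 0F) (X 0F 1F) (X 1F 0F) (X 1F 1F) r s ½))
      ψℍ-φ X 1F 1F = ≈-modulo 2½-1≈0 (≈-modulo r²+s²+1≈0
        (solve 7 (ψℍ-φ′ 1F 1F) refl (X 0F 0F) (X 0F 1F) (X 1F 0F) (X 1F 1F) r s ½))

      φ-cong : ∀ {X Y} → (∀ i j → X i j ≈ Y i j) → φ r s ½ X ≈ℍ φ r s ½ Y
      φ-cong e = *-congˡ (+-cong (e 0F 0F) (e 1F 1F)) ,
                 -‿cong (+-cong (*-congˡ u-cong) (*-congˡ v-cong)) ,
                 -‿cong (+-cong (*-congˡ u-cong) (-‿cong (*-congˡ v-cong))) ,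
                 *-congˡ (+-cong (e 0F 1F) (-‿cong (e 1F 0F)))
        where
        u-cong = *-congˡ (+-cong (e 0F 0F) (-‿cong (e 1F 1F)))
        v-cong = *-congˡ (+-cong (e 0F 1F) (e 1F 0F))

      ψ-injective : ∀ {M N} → ψ M ≈M4 ψ N → M ≈M2 N
      ψ-injective {M} {N} ψM≈ψN = ≈M2-by-entries λ B C →
        ≈ℍ-trans (≈ℍ-sym (φ-ψℍ (entry M B C))) (≈ℍ-trans (φ-cong (same-blocks B C)) (φ-ψℍ (entry N B C)))
        where
        same-blocks : ∀ B C i j → ψℍ (entry M B C) i j ≈ ψℍ (entry N B C) i j
        same-blocks B C i j = begin
          ψℍ (entry M B C) i j          ≡⟨ ψ-index M B C i j ⟨
          ψ M (index B i) (index C j)   ≈⟨ ψM≈ψN (index B i) (index C j) ⟩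
          ψ N (index B i) (index C j)   ≡⟨ ψ-index N B C i j ⟩
          ψℍ (entry N B C) i j          ∎

      Φ : M4 → M2ℍ
      Φ A = mat (φ r s ½ (block A 0F 0F)) (φ r s ½ (block A 0F 1F)) (φ r s ½ (block A 1F 0F)) (φ r s ½ (block A 1F 1F))

      entry-Φ : ∀ A B C → entry (Φ A) B C ≡ φ r s ½ (block A B C)
      entry-Φ A 0F 0F = ≡.refl
      entry-Φ A 0F 1F = ≡.refl
      entry-Φ A 1F 0F = ≡.refl
      entry-Φ A 1F 1F = ≡.refl

      ψ-Φ : ∀ A → ψ (Φ A) ≈M4 A
      ψ-Φ A i j = begin
        ψ (Φ A) i j
          ≡⟨ ≡.cong (λ x → ψℍ x (pos i) (pos j)) (entry-Φ A (blk i) (blk j)) ⟩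
        ψℍ (φ r s ½ (block A (blk i) (blk j))) (pos i) (pos j)
          ≈⟨ ψℍ-φ (block A (blk i) (blk j)) (pos i) (pos j) ⟩
        A (index (blk i) (pos i)) (index (blk j) (pos j))
          ≡⟨ ≡.cong₂ A (index-blk-pos i) (index-blk-pos j) ⟩
        A i j ∎

      halve : ∀ {x} → (1# + 1#) * x ≈ 0# → x ≈ 0#
      halve {x} 2x≈0 = begin
        x                    ≈⟨ *-identityˡ x ⟨
        1# * x               ≈⟨ *-congʳ ½-inverse ⟨
        ½ * (1# + 1#) * x    ≈⟨ *-assoc ½ (1# + 1#) x ⟩
        ½ * ((1# + 1#) * x)  ≈⟨ *-congˡ 2x≈0 ⟩
        ½ * 0#               ≈⟨ zeroʳ ½ ⟩
        0#                   ∎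

      symplectic⇒InGSV2 : ∀ M μ → IsUnit μ → symplecticForm M ≈M2 Jℍ μ → InGSV2 M
      symplectic⇒InGSV2 M@(mat a b c d) μ μ-unit (f₀₀ , f₀₁ , _ , f₁₁) =
        (μ , μ-unit , ≈ℍ-trans (≈ℍ-sym e₀₁) f₀₁) ,
        halve (k-part (a *ℍ (b *)) e₀₀ f₀₀) , halve (k-part (c *ℍ (d *)) e₁₁ f₁₁)
        where
        e = symplecticForm-≈ M
        e₀₀ = proj₁ e
        e₀₁ = proj₁ (proj₂ e)
        e₁₁ = proj₂ (proj₂ (proj₂ e))
        k-part : ∀ {x} y → x ≈ℍ twiceK y → x ≈ℍ scalarℍ 0# → (1# + 1#) * q3 y ≈ 0#
        k-part _ (_ , _ , _ , x≈2y) (_ , _ , _ , x≈0) = trans (sym x≈2y) x≈0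

      ψ-inducesIso : InducesIso
      ψ-inducesIso = record
        { maps-into    = λ M M∈GSV → let μ , μ-unit , form≈Jμ = InGSV2⇒symplectic M M∈GSV in
            μ , μ-unit , ≈M4-trans (≈M4-sym (ψ-symplecticForm M)) (≈M4-trans (ψ-cong form≈Jμ) (ψ-Jℍ μ))
        ; well-defined = λ { M N _ _ (λ′ , λ′-unit , N≈λ′M) →
            λ′ , λ′-unit , ≈M4-trans (ψ-cong N≈λ′M) (ψ-scaleM2 λ′ M) }
        ; homomorphism = λ M N _ _ → 1# , 1#-isUnit , λ i j → trans (sym (ψ-·M2 M N i j)) (sym (*-identityˡ _))
        ; injective    = λ { M N _ _ (λ′ , λ′-unit , ψN≈λ′ψM) →
            λ′ , λ′-unit , ψ-injective (≈M4-trans ψN≈λ′ψM (≈M4-sym (ψ-scaleM2 λ′ M))) }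
        ; surjective   = λ { A (μ , μ-unit , AJAᵗ≈μJ) →
            Φ A , symplectic⇒InGSV2 (Φ A) μ μ-unit (ψ-injective (symplectic-Φ A μ AJAᵗ≈μJ)) ,
            1# , 1#-isUnit , λ i j → trans (sym (ψ-Φ A i j)) (sym (*-identityˡ _)) }
        }
        where
        symplectic-Φ : ∀ A μ → A ·M4 J ·M4 transpose A ≈M4 scaleM4 μ J →
                       ψ (symplecticForm (Φ A)) ≈M4 ψ (Jℍ μ)
        symplectic-Φ A μ AJAᵗ≈μJ =
          ≈M4-trans (ψ-symplecticForm (Φ A))
            (≈M4-trans (·M4-cong (·M4-cong (ψ-Φ A) (≈M4-refl {J})) (λ i j → ψ-Φ A j i))
              (≈M4-trans AJAᵗ≈μJ (≈M4-sym (ψ-Jℍ μ))))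

module Congruence where
  open import Data.Nat
  open import Data.Nat.DivMod
  open import Data.Nat.Divisibility using (_∣_)
  open import Data.Nat.Properties
  open import Relation.Binary.PropositionalEquality

  module Modulo (m : ℕ) .{{_ : NonZero m}} where

    infix 4 _≋_
    _≋_ : ℕ → ℕ → Set
    x ≋ y = x % m ≡ y % m

    ≋-reflexive : ∀ {x y} → x ≡ y → x ≋ y
    ≋-reflexive = cong (_% m)

    ≋-% : ∀ x → x % m ≋ x
    ≋-% x = m%n%n≡m%n x m

    ≋-+ : ∀ {x x′ y y′} → x ≋ x′ → y ≋ y′ → x + y ≋ x′ + y′
    ≋-+ {x} {x′} {y} {y′} x≋x′ y≋y′ = begin
      (x + y) % m               ≡⟨ %-distribˡ-+ x y m ⟩
      (x % m + y % m) % m       ≡⟨ cong₂ (λ a b → (a + b) % m) x≋x′ y≋y′ ⟩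
      (x′ % m + y′ % m) % m     ≡⟨ %-distribˡ-+ x′ y′ m ⟨
      (x′ + y′) % m             ∎
      where open ≡-Reasoning

    ≋-* : ∀ {x x′ y y′} → x ≋ x′ → y ≋ y′ → x * y ≋ x′ * y′
    ≋-* {x} {x′} {y} {y′} x≋x′ y≋y′ = begin
      (x * y) % m               ≡⟨ %-distribˡ-* x y m ⟩
      (x % m * (y % m)) % m     ≡⟨ cong₂ (λ a b → (a * b) % m) x≋x′ y≋y′ ⟩
      (x′ % m * (y′ % m)) % m   ≡⟨ %-distribˡ-* x′ y′ m ⟨
      (x′ * y′) % m             ∎
      where open ≡-Reasoning

    ≋-cancelʳ-+ : ∀ {x y z} → x + z ≋ y + z → x ≋ y
    ≋-cancelʳ-+ {x} {y} {z} x+z≋y+z = begin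
      x % m                        ≡⟨ [m+kn]%n≡m%n x z m ⟨
      (x + z * m) % m              ≡⟨ cong (_% m) (split x) ⟩
      (x + z + z * ℕ.pred m) % m   ≡⟨ ≋-+ x+z≋y+z refl ⟩
      (y + z + z * ℕ.pred m) % m   ≡⟨ cong (_% m) (split y) ⟨
      (y + z * m) % m              ≡⟨ [m+kn]%n≡m%n y z m ⟩
      y % m                        ∎
      where
      open ≡-Reasoning
      -- adding z (m - 1) to both sides turns the added z into a multiple of m
      split : ∀ w → w + z * m ≡ w + z + z * ℕ.pred m
      split w = begin
        w + z * m                ≡⟨ cong (λ k → w + z * k) (suc-pred m) ⟨
        w + z * suc (ℕ.pred m)   ≡⟨ cong (w +_) (*-suc z (ℕ.pred m)) ⟩
        w + (z + z * ℕ.pred m)   ≡⟨ +-assoc w z _ ⟨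
        w + z + z * ℕ.pred m     ∎

  ≋-∣ : ∀ {m n x y} .{{_ : NonZero m}} .{{_ : NonZero n}} → m ∣ n → Modulo._≋_ n x y → Modulo._≋_ m x y
  ≋-∣ {m} {n} {x} {y} m∣n x≋y = begin
    x % m        ≡⟨ m∣n⇒o%n%m≡o%m m n x m∣n ⟨
    x % n % m    ≡⟨ cong (_% m) x≋y ⟩
    y % n % m    ≡⟨ m∣n⇒o%n%m≡o%m m n y m∣n ⟩
    y % m        ∎
    where open ≡-Reasoning

  ≋-modulus : ∀ {m m′ x y} .{{_ : NonZero m}} .{{_ : NonZero m′}} → m ≡ m′ → Modulo._≋_ m x y → Modulo._≋_ m′ x y
  ≋-modulus refl x≋y = x≋y

  ≋-*-cancelʳ : ∀ {m k x y} .{{_ : NonZero m}} .{{_ : NonZero k}} .{{_ : NonZero (m * k)}} →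
                Modulo._≋_ (m * k) (x * k) (y * k) → Modulo._≋_ m x y
  ≋-*-cancelʳ {m} {k} {x} {y} xk≋yk = *-cancelʳ-≡ (x % m) (y % m) k (begin
    x % m * k          ≡⟨ m%n*o≡m*o%[n*o] x m k ⟩
    x * k % (m * k)    ≡⟨ xk≋yk ⟩
    y * k % (m * k)    ≡⟨ m%n*o≡m*o%[n*o] y m k ⟨
    y % m * k          ∎)
    where open ≡-Reasoning

module ℤₚ (p : ℕ) .{{_ : NonZero p}} where
  open import Data.Fin using (toℕ; fromℕ<)
  open import Data.Fin.Properties using (toℕ<n; toℕ-injective; toℕ-fromℕ<)
  open import Data.Nat
  open import Data.Nat.DivMod
  open import Data.Nat.Divisibility using (divides)
  open import Data.Nat.Properties
  open import Data.Nat.Solver using (module +-*-Solver)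
  open import Relation.Binary.PropositionalEquality
  open PAdic p
  open Congruence

  module Mod (n : ℕ) = Modulo (p ^ n) {{m^n≢0 p n}}

  infixl 7 _%p^_
  _%p^_ : ℕ → ℕ → ℕ
  x %p^ n = _%_ x (p ^ n) {{m^n≢0 p n}}

  infix 4 _≡_[mod-p^_]
  _≡_[mod-p^_] : ℕ → ℕ → ℕ → Set
  x ≡ y [mod-p^ n ] = Mod._≋_ n x y

  digitOf-split : ∀ n x → x %p^ suc n ≡ x %p^ n + toℕ (digitOf n x) * p ^ n
  digitOf-split n x = begin
    x % p ^ suc n                                       ≡⟨ cong (_% p ^ suc n) x≡ ⟩
    (x % P + q % p * P + q / p * p ^ suc n) % p ^ suc n ≡⟨ [m+kn]%n≡m%n (x % P + q % p * P) (q / p) (p ^ suc n) ⟩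
    (x % P + q % p * P) % p ^ suc n                     ≡⟨ m<n⇒m%n≡m bound ⟩
    x % P + q % p * P                                   ≡⟨ cong (λ d → x % P + d * P) (toℕ-fromℕ< (m%n<n q p)) ⟨
    x % P + toℕ (digitOf n x) * P                       ∎
    where
    instance
      _ = m^n≢0 p n
      _ = m^n≢0 p (suc n)
    open ≡-Reasoning
    open +-*-Solver using (solve; _:=_; _:+_; _:*_)
    P = p ^ n
    q = x / P
    x≡ : x ≡ x % P + q % p * P + q / p * p ^ suc n
    x≡ = begin
      x                             ≡⟨ m≡m%n+[m/n]*n x P ⟩
      x % P + q * P                 ≡⟨ cong (λ k → x % P + k * P) (m≡m%n+[m/n]*n q p) ⟩
      x % P + (q % p + q / p * p) * P
        ≡⟨ solve 5 (λ a d e p P → a :+ (d :+ e :* p) :* P := a :+ d :* P :+ e :* (p :* P)) refl (x % P) (q % p) (q / p) p P ⟩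
      x % P + q % p * P + q / p * p ^ suc n ∎
    bound : x % P + q % p * P < p ^ suc n
    bound = <-≤-trans (+-monoˡ-< (q % p * P) (m%n<n x P)) (*-monoˡ-≤ P (m%n<n q p))

  trunc-< : ∀ n a → trunc n a < p ^ n
  trunc-< zero    a = z<s
  trunc-< (suc n) a = <-≤-trans (+-monoˡ-< (toℕ (a n) * p ^ n) (trunc-< n a)) (*-monoˡ-≤ (p ^ n) (toℕ<n (a n)))

  trunc-% : ∀ n a → trunc n a %p^ n ≡ trunc n a
  trunc-% n a = m<n⇒m%n≡m {{m^n≢0 p n}} (trunc-< n a)

  trunc-suc : ∀ n a → trunc (suc n) a ≡ trunc n a [mod-p^ n ]
  trunc-suc n a = [m+kn]%n≡m%n (trunc n a) (toℕ (a n)) (p ^ n) {{m^n≢0 p n}}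

  trunc-+ : ∀ k n a → trunc (k + n) a ≡ trunc n a [mod-p^ n ]
  trunc-+ zero    n a = refl
  trunc-+ (suc k) n a = trans (p^n-∣ (trunc-suc (k + n) a)) (trunc-+ k n a)
    where
    p^n-∣ : ∀ {x y} → x ≡ y [mod-p^ k + n ] → x ≡ y [mod-p^ n ]
    p^n-∣ = ≋-∣ {{m^n≢0 p n}} {{m^n≢0 p (k + n)}} (divides (p ^ k) (^-distribˡ-+-* p k n))

  digits : (ℕ → ℕ) → Zp
  digits f k = digitOf k (f k)

  Coherent : (ℕ → ℕ) → Set
  Coherent f = ∀ k → f (suc k) ≡ f k [mod-p^ suc k ]

  -- Each operation of `Defs` computes digit n from truncations of length n + 1, so this identifies its
  -- truncations with arithmetic modulo pⁿ.
  trunc-digits : ∀ f → Coherent f → ∀ n → trunc n (digits f) ≡ f n %p^ n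
  trunc-digits f coherent zero    = sym (n%1≡0 (f 0))
  trunc-digits f coherent (suc n) = begin
    trunc n (digits f) + toℕ (digitOf n (f n)) * p ^ n
      ≡⟨ cong (λ t → t + toℕ (digitOf n (f n)) * p ^ n) (trunc-digits f coherent n) ⟩
    f n %p^ n + toℕ (digitOf n (f n)) * p ^ n            ≡⟨ digitOf-split n (f n) ⟨
    f n %p^ suc n                                        ≡⟨ coherent n ⟨
    f (suc n) %p^ suc n                                  ∎
    where open ≡-Reasoning

  trunc-digits-≋ : ∀ f → Coherent f → ∀ n → trunc n (digits f) ≡ f n [mod-p^ n ]
  trunc-digits-≋ f coherent n = trans (cong (_%p^ n) (trunc-digits f coherent n)) (Mod.≋-% n (f n))

  trunc-fromℕ : ∀ n x → trunc n (fromℕ x) ≡ x [mod-p^ n ]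
  trunc-fromℕ n x = trunc-digits-≋ (λ _ → x) (λ _ → refl) n

  trunc-+Z : ∀ n a b → trunc n (a +Z b) ≡ trunc n a + trunc n b [mod-p^ n ]
  trunc-+Z n a b = trans (trunc-digits-≋ f coherent n) (Mod.≋-+ n (trunc-suc n a) (trunc-suc n b))
    where
    f : ℕ → ℕ
    f k = trunc (suc k) a + trunc (suc k) b
    coherent : Coherent f
    coherent k = Mod.≋-+ (suc k) (trunc-suc (suc k) a) (trunc-suc (suc k) b)

  trunc-*Z : ∀ n a b → trunc n (a *Z b) ≡ trunc n a * trunc n b [mod-p^ n ]
  trunc-*Z n a b = trans (trunc-digits-≋ f coherent n) (Mod.≋-* n (trunc-suc n a) (trunc-suc n b))
    where
    f : ℕ → ℕ
    f k = trunc (suc k) a * trunc (suc k) b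
    coherent : Coherent f
    coherent k = Mod.≋-* (suc k) (trunc-suc (suc k) a) (trunc-suc (suc k) b)

  0%p^n≡0 : ∀ n → 0 %p^ n ≡ 0
  0%p^n≡0 n = m<n⇒m%n≡m {{m^n≢0 p n}} (ℕ.>-nonZero⁻¹ (p ^ n) {{m^n≢0 p n}})

  p^n≡0 : ∀ n → p ^ n ≡ 0 [mod-p^ n ]
  p^n≡0 n = trans (n%n≡0 (p ^ n) {{m^n≢0 p n}}) (sym (0%p^n≡0 n))

  p^suc≡0 : ∀ n → p ^ suc n ≡ 0 [mod-p^ n ]
  p^suc≡0 n = trans (m*n%n≡0 p (p ^ n) {{m^n≢0 p n}}) (sym (0%p^n≡0 n))

  -- The truncated subtraction defining -Z never truncates, by trunc-<.
  trunc--Z : ∀ n a → trunc n (-Z a) + trunc n a ≡ 0 [mod-p^ n ]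
  trunc--Z n a = begin
    (trunc n (-Z a) + trunc n a) %p^ n      ≡⟨ Mod.≋-+ n (trunc-digits-≋ f coherent n) (sym (trunc-suc n a)) ⟩
    (f n + trunc (suc n) a) %p^ n           ≡⟨ cong (_%p^ n) (f+trunc n) ⟩
    p ^ suc n %p^ n                         ≡⟨ p^suc≡0 n ⟩
    0 %p^ n                                 ∎
    where
    open ≡-Reasoning
    f : ℕ → ℕ
    f k = p ^ suc k ∸ trunc (suc k) a
    f+trunc : ∀ k → f k + trunc (suc k) a ≡ p ^ suc k
    f+trunc k = m∸n+n≡m (<⇒≤ (trunc-< (suc k) a))
    coherent : Coherent f
    coherent k = Mod.≋-cancelʳ-+ (suc k) (begin
      (f (suc k) + trunc (suc k) a) %p^ suc k          ≡⟨ Mod.≋-+ (suc k) {f (suc k)} refl (sym (trunc-suc (suc k) a)) ⟩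
      (f (suc k) + trunc (suc (suc k)) a) %p^ suc k    ≡⟨ cong (_%p^ suc k) (f+trunc (suc k)) ⟩
      p ^ suc (suc k) %p^ suc k                        ≡⟨ p^suc≡0 (suc k) ⟩
      0 %p^ suc k                                      ≡⟨ p^n≡0 (suc k) ⟨
      p ^ suc k %p^ suc k                              ≡⟨ cong (_%p^ suc k) (f+trunc k) ⟨
      (f k + trunc (suc k) a) %p^ suc k                ∎)

  ≈Z⇒trunc≡ : ∀ {a b} → a ≈Z b → ∀ n → trunc n a ≡ trunc n b
  ≈Z⇒trunc≡ a≈b zero    = refl
  ≈Z⇒trunc≡ a≈b (suc n) = cong₂ (λ t d → t + toℕ d * p ^ n) (≈Z⇒trunc≡ a≈b n) (a≈b n)

  trunc≋⇒≈Z : ∀ {a b} → (∀ n → trunc n a ≡ trunc n b [mod-p^ n ]) → a ≈Z b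
  trunc≋⇒≈Z {a} {b} a≋b n = toℕ-injective (*-cancelʳ-≡ (toℕ (a n)) (toℕ (b n)) (p ^ n) {{m^n≢0 p n}}
    (+-cancelˡ-≡ (trunc n a) _ _ (trans (trunc≡ (suc n)) (cong (_+ toℕ (b n) * p ^ n) (sym (trunc≡ n))))))
    where
    trunc≡ : ∀ m → trunc m a ≡ trunc m b
    trunc≡ m = trans (sym (trunc-% m a)) (trans (a≋b m) (trunc-% m b))

  ≈Z-refl : ∀ {a} → a ≈Z a
  ≈Z-refl _ = refl

  ≈Z-sym : ∀ {a b} → a ≈Z b → b ≈Z a
  ≈Z-sym a≈b n = sym (a≈b n)

  ≈Z-trans : ∀ {a b c} → a ≈Z b → b ≈Z c → a ≈Z c
  ≈Z-trans a≈b b≈c n = trans (a≈b n) (b≈c n)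

  +Z-cong : ∀ {a a′ b b′} → a ≈Z a′ → b ≈Z b′ → (a +Z b) ≈Z (a′ +Z b′)
  +Z-cong a≈a′ b≈b′ n = cong₂ (λ x y → digitOf n (x + y)) (≈Z⇒trunc≡ a≈a′ (suc n)) (≈Z⇒trunc≡ b≈b′ (suc n))

  *Z-cong : ∀ {a a′ b b′} → a ≈Z a′ → b ≈Z b′ → (a *Z b) ≈Z (a′ *Z b′)
  *Z-cong a≈a′ b≈b′ n = cong₂ (λ x y → digitOf n (x * y)) (≈Z⇒trunc≡ a≈a′ (suc n)) (≈Z⇒trunc≡ b≈b′ (suc n))

  -Z-cong : ∀ {a a′} → a ≈Z a′ → (-Z a) ≈Z (-Z a′)
  -Z-cong a≈a′ n = cong (λ x → digitOf n (p ^ suc n ∸ x)) (≈Z⇒trunc≡ a≈a′ (suc n))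

  +Z-assoc : ∀ a b c → ((a +Z b) +Z c) ≈Z (a +Z (b +Z c))
  +Z-assoc a b c = trunc≋⇒≈Z λ n → begin
    trunc n ((a +Z b) +Z c) %p^ n                  ≡⟨ trunc-+Z n (a +Z b) c ⟩
    (trunc n (a +Z b) + trunc n c) %p^ n           ≡⟨ Mod.≋-+ n (trunc-+Z n a b) refl ⟩
    (trunc n a + trunc n b + trunc n c) %p^ n      ≡⟨ cong (_%p^ n) (+-assoc (trunc n a) _ _) ⟩
    (trunc n a + (trunc n b + trunc n c)) %p^ n    ≡⟨ Mod.≋-+ n {trunc n a} refl (trunc-+Z n b c) ⟨
    (trunc n a + trunc n (b +Z c)) %p^ n           ≡⟨ trunc-+Z n a (b +Z c) ⟨
    trunc n (a +Z (b +Z c)) %p^ n                  ∎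
    where open ≡-Reasoning

  +Z-comm : ∀ a b → (a +Z b) ≈Z (b +Z a)
  +Z-comm a b = trunc≋⇒≈Z λ n → begin
    trunc n (a +Z b) %p^ n             ≡⟨ trunc-+Z n a b ⟩
    (trunc n a + trunc n b) %p^ n      ≡⟨ cong (_%p^ n) (+-comm (trunc n a) _) ⟩
    (trunc n b + trunc n a) %p^ n      ≡⟨ trunc-+Z n b a ⟨
    trunc n (b +Z a) %p^ n             ∎
    where open ≡-Reasoning

  +Z-identityˡ : ∀ a → (fromℕ 0 +Z a) ≈Z a
  +Z-identityˡ a = trunc≋⇒≈Z λ n → begin
    trunc n (fromℕ 0 +Z a) %p^ n              ≡⟨ trunc-+Z n (fromℕ 0) a ⟩
    (trunc n (fromℕ 0) + trunc n a) %p^ n     ≡⟨ Mod.≋-+ n (trunc-fromℕ n 0) refl ⟩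
    trunc n a %p^ n                           ∎
    where open ≡-Reasoning

  -Z-inverseˡ : ∀ a → ((-Z a) +Z a) ≈Z fromℕ 0
  -Z-inverseˡ a = trunc≋⇒≈Z λ n → begin
    trunc n ((-Z a) +Z a) %p^ n               ≡⟨ trunc-+Z n (-Z a) a ⟩
    (trunc n (-Z a) + trunc n a) %p^ n        ≡⟨ trunc--Z n a ⟩
    0 %p^ n                                   ≡⟨ trunc-fromℕ n 0 ⟨
    trunc n (fromℕ 0) %p^ n                   ∎
    where open ≡-Reasoning

  *Z-assoc : ∀ a b c → ((a *Z b) *Z c) ≈Z (a *Z (b *Z c))
  *Z-assoc a b c = trunc≋⇒≈Z λ n → begin
    trunc n ((a *Z b) *Z c) %p^ n                  ≡⟨ trunc-*Z n (a *Z b) c ⟩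
    (trunc n (a *Z b) * trunc n c) %p^ n           ≡⟨ Mod.≋-* n (trunc-*Z n a b) refl ⟩
    (trunc n a * trunc n b * trunc n c) %p^ n      ≡⟨ cong (_%p^ n) (*-assoc (trunc n a) _ _) ⟩
    (trunc n a * (trunc n b * trunc n c)) %p^ n    ≡⟨ Mod.≋-* n {trunc n a} refl (trunc-*Z n b c) ⟨
    (trunc n a * trunc n (b *Z c)) %p^ n           ≡⟨ trunc-*Z n a (b *Z c) ⟨
    trunc n (a *Z (b *Z c)) %p^ n                  ∎
    where open ≡-Reasoning

  *Z-comm : ∀ a b → (a *Z b) ≈Z (b *Z a)
  *Z-comm a b = trunc≋⇒≈Z λ n → begin
    trunc n (a *Z b) %p^ n             ≡⟨ trunc-*Z n a b ⟩
    (trunc n a * trunc n b) %p^ n      ≡⟨ cong (_%p^ n) (*-comm (trunc n a) _) ⟩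
    (trunc n b * trunc n a) %p^ n      ≡⟨ trunc-*Z n b a ⟨
    trunc n (b *Z a) %p^ n             ∎
    where open ≡-Reasoning

  *Z-identityˡ : ∀ a → (fromℕ 1 *Z a) ≈Z a
  *Z-identityˡ a = trunc≋⇒≈Z λ n → begin
    trunc n (fromℕ 1 *Z a) %p^ n              ≡⟨ trunc-*Z n (fromℕ 1) a ⟩
    (trunc n (fromℕ 1) * trunc n a) %p^ n     ≡⟨ Mod.≋-* n (trunc-fromℕ n 1) refl ⟩
    (1 * trunc n a) %p^ n                     ≡⟨ cong (_%p^ n) (*-identityˡ (trunc n a)) ⟩
    trunc n a %p^ n                           ∎
    where open ≡-Reasoning

  *Z-distribˡ-+Z : ∀ a b c → (a *Z (b +Z c)) ≈Z ((a *Z b) +Z (a *Z c))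
  *Z-distribˡ-+Z a b c = trunc≋⇒≈Z λ n → begin
    trunc n (a *Z (b +Z c)) %p^ n                              ≡⟨ trunc-*Z n a (b +Z c) ⟩
    (trunc n a * trunc n (b +Z c)) %p^ n                       ≡⟨ Mod.≋-* n {trunc n a} refl (trunc-+Z n b c) ⟩
    (trunc n a * (trunc n b + trunc n c)) %p^ n                ≡⟨ cong (_%p^ n) (*-distribˡ-+ (trunc n a) _ _) ⟩
    (trunc n a * trunc n b + trunc n a * trunc n c) %p^ n      ≡⟨ Mod.≋-+ n (trunc-*Z n a b) (trunc-*Z n a c) ⟨
    (trunc n (a *Z b) + trunc n (a *Z c)) %p^ n                ≡⟨ trunc-+Z n (a *Z b) (a *Z c) ⟨
    trunc n ((a *Z b) +Z (a *Z c)) %p^ n                       ∎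
    where open ≡-Reasoning

  ℤₚ-setoid : Setoid 0ℓ 0ℓ
  ℤₚ-setoid = record
    { Carrier = Zp ; _≈_ = _≈Z_
    ; isEquivalence = record { refl = ≈Z-refl ; sym = ≈Z-sym ; trans = ≈Z-trans }
    }

  ℤₚ-commutativeRing : CommutativeRing 0ℓ 0ℓ
  ℤₚ-commutativeRing = record
    { Carrier = Zp ; _≈_ = _≈Z_ ; _+_ = _+Z_ ; _*_ = _*Z_ ; -_ = -Z_ ; 0# = fromℕ 0 ; 1# = fromℕ 1
    ; isCommutativeRing = record
      { isRing = record
        { +-isAbelianGroup = record
          { isGroup = record
            { isMonoid = record
              { isSemigroup = record
                { isMagma  = record { isEquivalence = Setoid.isEquivalence ℤₚ-setoid ; ∙-cong = +Z-cong }
                ; assoc    = +Z-assoc }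
              ; identity = comm∧idˡ⇒id +Z-comm +Z-identityˡ }
            ; inverse = comm∧invˡ⇒inv +Z-comm -Z-inverseˡ
            ; ⁻¹-cong = -Z-cong }
          ; comm = +Z-comm }
        ; *-cong     = *Z-cong
        ; *-assoc    = *Z-assoc
        ; *-identity = comm∧idˡ⇒id *Z-comm *Z-identityˡ
        ; distrib    = comm∧distrˡ⇒distr +Z-cong *Z-comm *Z-distribˡ-+Z }
      ; *-comm = *Z-comm }
    }
    where open import Algebra.Consequences.Setoid ℤₚ-setoid

  p^-cancelˡ : ∀ l n {x y} → p ^ l * x ≡ p ^ l * y [mod-p^ n + l ] → x ≡ y [mod-p^ n ]
  p^-cancelˡ l n {x} {y} pˡx≋pˡy = ≋-*-cancelʳ {p ^ n} {p ^ l} (≋-modulus (^-distribˡ-+-* p n l) xpˡ≋ypˡ)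
    where
    instance
      _ = m^n≢0 p n
      _ = m^n≢0 p l
      _ = m^n≢0 p (n + l)
      _ = m*n≢0 (p ^ n) (p ^ l)
    xpˡ≋ypˡ : x * p ^ l ≡ y * p ^ l [mod-p^ n + l ]
    xpˡ≋ypˡ = subst₂ (λ u v → u ≡ v [mod-p^ n + l ]) (*-comm (p ^ l) x) (*-comm (p ^ l) y) pˡx≋pˡy

  module MinusHalf (c : ℕ) (2c+1≡p : c * 2 + 1 ≡ p) where

    c<p : c < p
    c<p = subst (c <_) 2c+1≡p (≤-<-trans (m≤m*n c 2) (m<m+n (c * 2) z<s))

    -- The constant digit c = (p - 1)/2 is -1/2, since 2 (c + c p + ... + c pⁿ⁻¹) + 1 = pⁿ.
    -½ : Zp
    -½ _ = fromℕ< c<p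

    2trunc-½+1≡p^n : ∀ n → trunc n -½ * 2 + 1 ≡ p ^ n
    2trunc-½+1≡p^n zero    = refl
    2trunc-½+1≡p^n (suc n) = begin
      (trunc n -½ + toℕ (fromℕ< c<p) * p ^ n) * 2 + 1
        ≡⟨ cong (λ d → (trunc n -½ + d * p ^ n) * 2 + 1) (toℕ-fromℕ< c<p) ⟩
      (trunc n -½ + c * p ^ n) * 2 + 1
        ≡⟨ solve 3 (λ t c P → (t :+ c :* P) :* con 2 :+ con 1 := (t :* con 2 :+ con 1) :+ c :* con 2 :* P)
                 refl (trunc n -½) c (p ^ n) ⟩
      (trunc n -½ * 2 + 1) + c * 2 * p ^ n             ≡⟨ cong (_+ c * 2 * p ^ n) (2trunc-½+1≡p^n n) ⟩
      p ^ n + c * 2 * p ^ n                             ≡⟨ cong (p ^ n +_) (*-comm (c * 2) (p ^ n)) ⟩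
      p ^ n + p ^ n * (c * 2)                           ≡⟨ *-suc (p ^ n) (c * 2) ⟨
      p ^ n * suc (c * 2)                               ≡⟨ cong (p ^ n *_) (trans (+-comm 1 (c * 2)) 2c+1≡p) ⟩
      p ^ n * p                                         ≡⟨ *-comm (p ^ n) p ⟩
      p ^ suc n                                         ∎
      where
      open ≡-Reasoning
      open +-*-Solver using (solve; _:=_; _:+_; _:*_; con)

    -½+-½+1≈0 : ((-½ +Z -½) +Z fromℕ 1) ≈Z fromℕ 0
    -½+-½+1≈0 = trunc≋⇒≈Z λ n → begin
      trunc n ((-½ +Z -½) +Z fromℕ 1) %p^ n                ≡⟨ trunc-+Z n (-½ +Z -½) (fromℕ 1) ⟩
      (trunc n (-½ +Z -½) + trunc n (fromℕ 1)) %p^ n       ≡⟨ Mod.≋-+ n (trunc-+Z n -½ -½) (trunc-fromℕ n 1) ⟩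
      (trunc n -½ + trunc n -½ + 1) %p^ n                  ≡⟨ cong (λ t → (t + 1) %p^ n) (+-*-double (trunc n -½)) ⟩
      (trunc n -½ * 2 + 1) %p^ n                           ≡⟨ cong (_%p^ n) (2trunc-½+1≡p^n n) ⟩
      p ^ n %p^ n                                          ≡⟨ p^n≡0 n ⟩
      0 %p^ n                                              ≡⟨ trunc-fromℕ n 0 ⟨
      trunc n (fromℕ 0) %p^ n                              ∎
      where
      open ≡-Reasoning
      +-*-double : ∀ t → t + t ≡ t * 2
      +-*-double t = trans (cong (t +_) (sym (+-identityʳ t))) (*-comm 2 t)

    ½ : Zp
    ½ = -Z -½

    ½-inverse : (½ *Z (fromℕ 1 +Z fromℕ 1)) ≈Z fromℕ 1
    ½-inverse = begin
      ½ *Z (fromℕ 1 +Z fromℕ 1)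
        ≈⟨ solve 1 (λ g → :- g :* (one :+ one) := one :+ :- (g :+ g :+ one)) ≈Z-refl -½ ⟩
      fromℕ 1 +Z (-Z ((-½ +Z -½) +Z fromℕ 1))     ≈⟨ +-congˡ (-‿cong -½+-½+1≈0) ⟩
      fromℕ 1 +Z (-Z fromℕ 0)                     ≈⟨ +-congˡ -0#≈0# ⟩
      fromℕ 1 +Z fromℕ 0                          ≈⟨ +Z-identityʳ (fromℕ 1) ⟩
      fromℕ 1                                     ∎
      where
      open CommutativeRing ℤₚ-commutativeRing using (+-congˡ; -‿cong; ring) renaming (+-identityʳ to +Z-identityʳ)
      open CommutativeRingSolver ℤₚ-commutativeRing using (solve; _:=_; _:+_; _:*_; :-_; con)
      open import Algebra.Properties.Ring ring using (-0#≈0#)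
      one = con (1 , 0)
      open import Relation.Binary.Reasoning.Setoid ℤₚ-setoid

module ℚₚ (p : ℕ) .{{_ : NonZero p}} where
  open import Data.Nat using (_^_)
  open PAdic p
  open ℤₚ p
    using (ℤₚ-commutativeRing; module Mod; _≡_[mod-p^_]; trunc≋⇒≈Z; ≈Z⇒trunc≡; trunc-*Z; trunc-fromℕ; trunc-+; p^-cancelˡ)
  open CommutativeRing ℤₚ-commutativeRing
  open CommutativeRingSolver ℤₚ-commutativeRing using (solve; _:=_; _:+_; _:*_; :-_; con)
  open import Relation.Binary.Reasoning.Setoid setoid

  [p^_] : ℕ → Zp
  [p^ k ] = fromℕ (p ^ k)

  fromℕ-* : ∀ x y → fromℕ (x ℕ.* y) ≈ fromℕ x * fromℕ y
  fromℕ-* x y = trunc≋⇒≈Z λ n →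
    ≡.trans (trunc-fromℕ n (x ℕ.* y))
            (≡.sym (≡.trans (trunc-*Z n (fromℕ x) (fromℕ y)) (Mod.≋-* n (trunc-fromℕ n x) (trunc-fromℕ n y))))

  [p^]-+ : ∀ k l → [p^ k ℕ.+ l ] ≈ [p^ k ] * [p^ l ]
  [p^]-+ k l = trans (reflexive (≡.cong fromℕ (ℕ.^-distribˡ-+-* p k l))) (fromℕ-* (p ^ k) (p ^ l))

  [p^]-cancelˡ : ∀ l {x y} → [p^ l ] * x ≈ [p^ l ] * y → x ≈ y
  [p^]-cancelˡ l {x} {y} pˡx≈pˡy = trunc≋⇒≈Z λ n →
    ≡.trans (≡.sym (trunc-+′ n x)) (≡.trans (p^-cancelˡ l n (shifted n)) (trunc-+′ n y))
    where
    trunc-+′ : ∀ n z → trunc (n ℕ.+ l) z ≡ trunc n z [mod-p^ n ]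
    trunc-+′ n z = ≡.subst (λ m → trunc m z ≡ trunc n z [mod-p^ n ]) (ℕ.+-comm l n) (trunc-+ l n z)
    shifted : ∀ n → p ^ l ℕ.* trunc (n ℕ.+ l) x ≡ p ^ l ℕ.* trunc (n ℕ.+ l) y [mod-p^ n ℕ.+ l ]
    shifted n = ≡.trans (≡.sym (side x)) (≡.trans (Mod.≋-reflexive m (≈Z⇒trunc≡ pˡx≈pˡy m)) (side y))
      where
      m = n ℕ.+ l
      side : ∀ z → trunc m ([p^ l ] * z) ≡ p ^ l ℕ.* trunc m z [mod-p^ m ]
      side z = ≡.trans (trunc-*Z m [p^ l ] z) (Mod.≋-* m (trunc-fromℕ m (p ^ l)) ≡.refl)

  open RawRing QpRing using () renaming (_+_ to _⊕_; _*_ to _⊗_; -_ to ⊖_; 0# to 0Q; 1# to 1Q)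

  ≈Q-refl : ∀ {x} → x ≈Q x
  ≈Q-refl {a /p^ k} = refl

  ≈Q-sym : ∀ {x y} → x ≈Q y → y ≈Q x
  ≈Q-sym {a /p^ k} {b /p^ l} = sym

  ≈Q-trans : ∀ {x y z} → x ≈Q y → y ≈Q z → x ≈Q z
  ≈Q-trans {a /p^ k} {b /p^ l} {c /p^ m} pˡa≈pᵏb pᵐb≈pˡc = [p^]-cancelˡ l (begin
    [p^ l ] * ([p^ m ] * a)   ≈⟨ solve 3 (λ L M a → L :* (M :* a) := M :* (L :* a)) refl [p^ l ] [p^ m ] a ⟩
    [p^ m ] * ([p^ l ] * a)   ≈⟨ *-congˡ pˡa≈pᵏb ⟩
    [p^ m ] * ([p^ k ] * b)   ≈⟨ solve 3 (λ M K b → M :* (K :* b) := K :* (M :* b)) refl [p^ m ] [p^ k ] b ⟩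
    [p^ k ] * ([p^ m ] * b)   ≈⟨ *-congˡ pᵐb≈pˡc ⟩
    [p^ k ] * ([p^ l ] * c)   ≈⟨ solve 3 (λ K L c → K :* (L :* c) := L :* (K :* c)) refl [p^ k ] [p^ l ] c ⟩
    [p^ l ] * ([p^ k ] * c)   ∎)

  ℚₚ-setoid : Setoid 0ℓ 0ℓ
  ℚₚ-setoid = record
    { Carrier = Qp ; _≈_ = _≈Q_
    ; isEquivalence = record
      { refl = λ {x} → ≈Q-refl {x} ; sym = λ {x} {y} → ≈Q-sym {x} {y} ; trans = λ {x} {y} {z} → ≈Q-trans {x} {y} {z} }
    }

  ⊕-cong : ∀ {x x′ y y′} → x ≈Q x′ → y ≈Q y′ → (x ⊕ y) ≈Q (x′ ⊕ y′)
  ⊕-cong {a /p^ k} {a′ /p^ k′} {b /p^ l} {b′ /p^ l′} a≈a′ b≈b′ = begin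
    [p^ k′ ℕ.+ l′ ] * ([p^ l ] * a + [p^ k ] * b)             ≈⟨ *-congʳ ([p^]-+ k′ l′) ⟩
    ([p^ k′ ] * [p^ l′ ]) * ([p^ l ] * a + [p^ k ] * b)
      ≈⟨ solve 6 (λ K′ L′ L K a b → (K′ :* L′) :* (L :* a :+ K :* b)
                                  := (L :* L′) :* (K′ :* a) :+ (K :* K′) :* (L′ :* b))
               refl [p^ k′ ] [p^ l′ ] [p^ l ] [p^ k ] a b ⟩
    ([p^ l ] * [p^ l′ ]) * ([p^ k′ ] * a) + ([p^ k ] * [p^ k′ ]) * ([p^ l′ ] * b)
      ≈⟨ +-cong (*-congˡ a≈a′) (*-congˡ b≈b′) ⟩
    ([p^ l ] * [p^ l′ ]) * ([p^ k ] * a′) + ([p^ k ] * [p^ k′ ]) * ([p^ l ] * b′)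
      ≈⟨ solve 6 (λ K′ L′ L K a′ b′ → (L :* L′) :* (K :* a′) :+ (K :* K′) :* (L :* b′)
                                    := (K :* L) :* (L′ :* a′ :+ K′ :* b′))
               refl [p^ k′ ] [p^ l′ ] [p^ l ] [p^ k ] a′ b′ ⟩
    ([p^ k ] * [p^ l ]) * ([p^ l′ ] * a′ + [p^ k′ ] * b′)     ≈⟨ *-congʳ ([p^]-+ k l) ⟨
    [p^ k ℕ.+ l ] * ([p^ l′ ] * a′ + [p^ k′ ] * b′)           ∎

  ⊗-cong : ∀ {x x′ y y′} → x ≈Q x′ → y ≈Q y′ → (x ⊗ y) ≈Q (x′ ⊗ y′)
  ⊗-cong {a /p^ k} {a′ /p^ k′} {b /p^ l} {b′ /p^ l′} a≈a′ b≈b′ = begin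
    [p^ k′ ℕ.+ l′ ] * (a * b)         ≈⟨ *-congʳ ([p^]-+ k′ l′) ⟩
    ([p^ k′ ] * [p^ l′ ]) * (a * b)   ≈⟨ *-interchange [p^ k′ ] [p^ l′ ] a b ⟩
    ([p^ k′ ] * a) * ([p^ l′ ] * b)   ≈⟨ *-cong a≈a′ b≈b′ ⟩
    ([p^ k ] * a′) * ([p^ l ] * b′)   ≈⟨ *-interchange [p^ k ] a′ [p^ l ] b′ ⟩
    ([p^ k ] * [p^ l ]) * (a′ * b′)   ≈⟨ *-congʳ ([p^]-+ k l) ⟨
    [p^ k ℕ.+ l ] * (a′ * b′)         ∎
    where open import Algebra.Properties.CommutativeSemigroup *-commutativeSemigroup renaming (interchange to *-interchange)

  ⊖-cong : ∀ {x x′} → x ≈Q x′ → (⊖ x) ≈Q (⊖ x′)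
  ⊖-cong {a /p^ k} {a′ /p^ k′} a≈a′ = begin
    [p^ k′ ] * (- a)    ≈⟨ -‿distribʳ-* [p^ k′ ] a ⟨
    - ([p^ k′ ] * a)    ≈⟨ -‿cong a≈a′ ⟩
    - ([p^ k ] * a′)    ≈⟨ -‿distribʳ-* [p^ k ] a′ ⟩
    [p^ k ] * (- a′)    ∎
    where open import Algebra.Properties.Ring ring using (-‿distribʳ-*)

  ⊕-assoc : ∀ x y z → ((x ⊕ y) ⊕ z) ≈Q (x ⊕ (y ⊕ z))
  ⊕-assoc (a /p^ k) (b /p^ l) (c /p^ m) = begin
    [p^ k ℕ.+ (l ℕ.+ m) ] * (M * (L * a + K * b) + [p^ k ℕ.+ l ] * c)
      ≈⟨ *-cong (trans ([p^]-+ k (l ℕ.+ m)) (*-congˡ ([p^]-+ l m))) (+-congˡ (*-congʳ ([p^]-+ k l))) ⟩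
    (K * (L * M)) * (M * (L * a + K * b) + (K * L) * c)
      ≈⟨ *-cong (sym (*-assoc K L M))
                (solve 6 (λ K L M a b c → M :* (L :* a :+ K :* b) :+ (K :* L) :* c
                                        := (L :* M) :* a :+ K :* (M :* b :+ L :* c)) refl K L M a b c) ⟩
    ((K * L) * M) * ((L * M) * a + K * (M * b + L * c))
      ≈⟨ *-cong (sym (trans ([p^]-+ (k ℕ.+ l) m) (*-congʳ ([p^]-+ k l)))) (+-congʳ (*-congʳ (sym ([p^]-+ l m)))) ⟩
    [p^ (k ℕ.+ l) ℕ.+ m ] * ([p^ l ℕ.+ m ] * a + K * (M * b + L * c)) ∎
    where
    K = [p^ k ]
    L = [p^ l ]
    M = [p^ m ]

  ⊕-comm : ∀ x y → (x ⊕ y) ≈Q (y ⊕ x)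
  ⊕-comm (a /p^ k) (b /p^ l) = *-cong (reflexive (≡.cong [p^_] (ℕ.+-comm l k))) (+-comm _ _)

  ⊕-identityˡ : ∀ x → (0Q ⊕ x) ≈Q x
  ⊕-identityˡ (a /p^ k) = solve 2 (λ K a → K :* (K :* con (0 , 0) :+ con (1 , 0) :* a) := K :* a) refl [p^ k ] a

  ⊖-inverseˡ : ∀ x → ((⊖ x) ⊕ x) ≈Q 0Q
  ⊖-inverseˡ (a /p^ k) =
    solve 3 (λ K K² a → con (1 , 0) :* (K :* (:- a) :+ K :* a) := K² :* con (0 , 0)) refl [p^ k ] [p^ k ℕ.+ k ] a

  ⊗-assoc : ∀ x y z → ((x ⊗ y) ⊗ z) ≈Q (x ⊗ (y ⊗ z))
  ⊗-assoc (a /p^ k) (b /p^ l) (c /p^ m) = *-cong (reflexive (≡.cong [p^_] (≡.sym (ℕ.+-assoc k l m)))) (*-assoc a b c)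

  ⊗-comm : ∀ x y → (x ⊗ y) ≈Q (y ⊗ x)
  ⊗-comm (a /p^ k) (b /p^ l) = *-cong (reflexive (≡.cong [p^_] (ℕ.+-comm l k))) (*-comm a b)

  ⊗-identityˡ : ∀ x → (1Q ⊗ x) ≈Q x
  ⊗-identityˡ (a /p^ k) = *-congˡ (*-identityˡ a)

  ⊗-distribˡ-⊕ : ∀ x y z → (x ⊗ (y ⊕ z)) ≈Q ((x ⊗ y) ⊕ (x ⊗ z))
  ⊗-distribˡ-⊕ (a /p^ k) (b /p^ l) (c /p^ m) = begin
    [p^ (k ℕ.+ l) ℕ.+ (k ℕ.+ m) ] * (a * (M * b + L * c))
      ≈⟨ *-congʳ (trans ([p^]-+ (k ℕ.+ l) (k ℕ.+ m)) (*-cong ([p^]-+ k l) ([p^]-+ k m))) ⟩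
    ((K * L) * (K * M)) * (a * (M * b + L * c))
      ≈⟨ *-congʳ (solve 3 (λ K L M → (K :* L) :* (K :* M) := (K :* (L :* M)) :* K) refl K L M) ⟩
    ((K * (L * M)) * K) * (a * (M * b + L * c))
      ≈⟨ *-assoc (K * (L * M)) K _ ⟩
    (K * (L * M)) * (K * (a * (M * b + L * c)))
      ≈⟨ *-congˡ (solve 6 (λ K L M a b c → K :* (a :* (M :* b :+ L :* c)) := (K :* M) :* (a :* b) :+ (K :* L) :* (a :* c))
                          refl K L M a b c) ⟩
    (K * (L * M)) * ((K * M) * (a * b) + (K * L) * (a * c))
      ≈⟨ *-cong (sym (trans ([p^]-+ k (l ℕ.+ m)) (*-congˡ ([p^]-+ l m))))
                (+-cong (*-congʳ (sym ([p^]-+ k m))) (*-congʳ (sym ([p^]-+ k l)))) ⟩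
    [p^ k ℕ.+ (l ℕ.+ m) ] * ([p^ k ℕ.+ m ] * (a * b) + [p^ k ℕ.+ l ] * (a * c)) ∎
    where
    K = [p^ k ]
    L = [p^ l ]
    M = [p^ m ]

  ι-+ : ∀ a b → (ι a ⊕ ι b) ≈Q ι (a +Z b)
  ι-+ a b = *-congˡ (+-cong (*-identityˡ a) (*-identityˡ b))

  ι-cong : ∀ {a b} → a ≈Z b → ι a ≈Q ι b
  ι-cong = *-congˡ

  ℚₚ-commutativeRing : CommutativeRing 0ℓ 0ℓ
  ℚₚ-commutativeRing = record
    { Carrier = Qp ; _≈_ = _≈Q_ ; _+_ = _⊕_ ; _*_ = _⊗_ ; -_ = ⊖_ ; 0# = 0Q ; 1# = 1Q
    ; isCommutativeRing = record
      { isRing = record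
        { +-isAbelianGroup = record
          { isGroup = record
            { isMonoid = record
              { isSemigroup = record
                { isMagma  = record { isEquivalence = Setoid.isEquivalence ℚₚ-setoid
                                    ; ∙-cong = λ {x} {x′} {y} {y′} → ⊕-cong {x} {x′} {y} {y′} }
                ; assoc    = ⊕-assoc }
              ; identity = comm∧idˡ⇒id {_∙_ = _⊕_} ⊕-comm {e = 0Q} ⊕-identityˡ }
            ; inverse = comm∧invˡ⇒inv {_∙_ = _⊕_} {_⁻¹ = ⊖_} {e = 0Q} ⊕-comm ⊖-inverseˡ
            ; ⁻¹-cong = λ {x} {x′} → ⊖-cong {x} {x′} }
          ; comm = ⊕-comm }
        ; *-cong     = λ {x} {x′} {y} {y′} → ⊗-cong {x} {x′} {y} {y′}
        ; *-assoc    = ⊗-assoc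
        ; *-identity = comm∧idˡ⇒id {_∙_ = _⊗_} ⊗-comm {e = 1Q} ⊗-identityˡ
        ; distrib    = comm∧distrˡ⇒distr {_∙_ = _⊗_} {_◦_ = _⊕_} (λ {x} {x′} {y} {y′} → ⊕-cong {x} {x′} {y} {y′})
                                         ⊗-comm ⊗-distribˡ-⊕ }
      ; *-comm = ⊗-comm }
    }
    where open import Algebra.Consequences.Setoid ℚₚ-setoid

prime≢2⇒odd : ∀ p → Prime p → p ≢ 2 → ∃ λ c → c ℕ.* 2 ℕ.+ 1 ≡ p
prime≢2⇒odd p p-prime p≢2 with p ℕ.% 2 in p%2≡ | ℕ.m%n<n p 2
... | 0               | _ = contradiction (prime⇒irreducible p-prime (m%n≡0⇒n∣m p 2 p%2≡)) 2≢1∧2≢p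
  where
  open import Data.Nat.Divisibility using (m%n≡0⇒n∣m)
  open import Data.Nat.Primality using (prime⇒irreducible)
  open import Data.Sum using (_⊎_; inj₁; inj₂)
  open import Relation.Nullary using (¬_; contradiction)
  2≢1∧2≢p : ¬ (2 ≡ 1 ⊎ 2 ≡ p)
  2≢1∧2≢p (inj₁ ())
  2≢1∧2≢p (inj₂ 2≡p) = p≢2 (≡.sym 2≡p)
... | 1               | _ = p ℕ./ 2 , (begin
  p ℕ./ 2 ℕ.* 2 ℕ.+ 1        ≡⟨ ℕ.+-comm (p ℕ./ 2 ℕ.* 2) 1 ⟩
  1 ℕ.+ p ℕ./ 2 ℕ.* 2        ≡⟨ ≡.cong (ℕ._+ p ℕ./ 2 ℕ.* 2) p%2≡ ⟨
  p ℕ.% 2 ℕ.+ p ℕ./ 2 ℕ.* 2  ≡⟨ ℕ.m≡m%n+[m/n]*n p 2 ⟨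
  p                          ∎)
  where open ≡.≡-Reasoning
... | ℕ.suc (ℕ.suc _) | ℕ.s≤s (ℕ.s≤s ())

lemma5p1 : (p : ℕ) .{{_ : NonZero p}} → Prime p → p ≢ 2 →
    (r s : PAdic.Zp p) →
    PAdic.SumSqMinusOne p r s →
      OverRing.Psi.InducesIso (PAdic.QpRing p) (PAdic.ι p r) (PAdic.ι p s)
      × OverRing.Psi.InducesIso (PAdic.ZpRing p) r s
lemma5p1 p p-prime p≢2 r s r²+s²≈-1 with prime≢2⇒odd p p-prime p≢2
... | c , 2c+1≡p =
  PsiIsomorphism.ψ-inducesIso ℚₚ-commutativeRing (ι r) (ι s) ι[r²+s²≈-1] (ι ½) ι[½-inverse] ,
  PsiIsomorphism.ψ-inducesIso ℤₚ-commutativeRing r s r²+s²≈-1 ½ ½-inverse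
  where
  open PAdic p
  open ℤₚ p using (ℤₚ-commutativeRing)
  open ℤₚ.MinusHalf p c 2c+1≡p using (½; ½-inverse)
  open ℚₚ p using (ℚₚ-setoid; ℚₚ-commutativeRing; ≈Q-refl; ⊗-cong; ι-+; ι-cong)
  open RawRing QpRing using () renaming (_+_ to _⊕_; _*_ to _⊗_; -_ to ⊖_; 1# to 1Q)
  open import Relation.Binary.Reasoning.Setoid ℚₚ-setoid

  ι[r²+s²≈-1] : ((ι r ⊗ ι r) ⊕ (ι s ⊗ ι s)) ≈Q (⊖ 1Q)
  ι[r²+s²≈-1] = begin
    (ι r ⊗ ι r) ⊕ (ι s ⊗ ι s)   ≈⟨ ι-+ (r *Z r) (s *Z s) ⟩
    ι ((r *Z r) +Z (s *Z s))    ≈⟨ ι-cong r²+s²≈-1 ⟩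
    ⊖ 1Q                        ∎

  ι[½-inverse] : (ι ½ ⊗ (1Q ⊕ 1Q)) ≈Q 1Q
  ι[½-inverse] = begin
    ι ½ ⊗ (1Q ⊕ 1Q)
      ≈⟨ ⊗-cong {ι ½} {ι ½} {1Q ⊕ 1Q} {ι (fromℕ 1 +Z fromℕ 1)} (≈Q-refl {ι ½}) (ι-+ (fromℕ 1) (fromℕ 1)) ⟩
    ι ½ ⊗ ι (fromℕ 1 +Z fromℕ 1)
      ≈⟨ ι-cong ½-inverse ⟩
    1Q ∎
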